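{- Let $f(x)=ax^2+bx+c$ be an irreducible polynomial in $\mathbb{Z}[x]$ and $D=b^2-4ac$. For a prime $p$ and integer $k\ge 1$ let $s(f,p^k)$ be the number of integers $0\le x<p^k$ with $f(x)\equiv 0\pmod{p^k}$. Then: (1) If $p\nmid 2a$, $D=p^lD_p$ with $p\nmid D_p$, then $s(f,p^k)=p^{\lfloor k/2\rfloor}$ if $k\le l$; $s(f,p^k)=0$ if $k>l$ and ($l$ is odd or $(D_p/p)=-1$); $s(f,p^k)=2p^{l/2}$ if $k>l$, $l$ is even and $(D_p/p)=1$. (2) If $p\mid a$ and $p\neq 2$, then $s(f,p^k)=0$ if $p\mid b$, and $s(f,p^k)=1$ if $p\nmid b$. (3) If $b$ is odd, then for all $k\ge 2$, $s(f,2^k)=s(f,2)$, and $s(f,2)=1$ if $a$ is even, $s(f,2)=0$ if $a$ and $c$ are odd, $s(f,2)=2$ if $a$ is odd and $c$ is even. (4) If $b$ and $a$ are both even, then $s(f,2^k)=0$ for every $k\ge 1$. (5) If $b$ is even and $a$ is odd, write $D=4^lD'$ with $D'\not\equiv 0\pmod 4$. Then: (a) if $k\le 2l-1$, $s(f,2^k)=2^{\lfloor k/2\rfloor}$; (b) if $k=2l$, $s(f,2^k)=2^l$ when $D'\equiv 1\pmod 4$ and $0$ otherwise; (c) if $k\ge 2l+1$, $s(f,2^k)=2^{l+1}$ when $D'\equiv 1\pmod 8$ and $0$ otherwise.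
   Context: $(x/p)$ for an odd prime $p$ denotes the Legendre symbol. Irreducible in $\mathbb{Z}[x]$ (in particular $\gcd(a,b,c)=1$ and $D$ is not a perfect square). -}

module Defs where

open import Data.Nat as ℕ using (ℕ)
import Data.Nat.Divisibility as ℕD
open import Data.Integer using (ℤ; +_; _+_; _-_; _*_; ∣_∣; -_; 0ℤ; 1ℤ; -1ℤ)
open import Data.Integer.Divisibility using (_∣_)
open import Data.List using (List; length; filter; upTo; any)
open import Data.List.Relation.Unary.Any using (Any)
import Data.List.Relation.Unary.Any as Any
open import Data.Product using (_×_)
open import Data.Sum using (_⊎_)
open import Data.Empty using (⊥)
open import Relation.Nullary using (¬_; Dec; yes; no)
open import Relation.Binary.PropositionalEquality using (_≡_; _≢_)

-- divisibility in ℤ is decidable (ℤ's _∣_ is ℕ's _∣_ on absolute values)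
_∣ℤ?_ : (d n : ℤ) → Dec (d ∣ n)
d ∣ℤ? n = ∣ d ∣ ℕD.∣? ∣ n ∣

quad : ℤ → ℤ → ℤ → ℤ → ℤ
quad a b c x = a * x * x + b * x + c

numRoots : ℤ → ℤ → ℤ → ℕ → ℕ
numRoots a b c m =
  length (filter (λ x → (+ m) ∣ℤ? quad a b c (+ x)) (upTo m))

legendre : ℤ → ℕ → ℤ
legendre d p with (+ p) ∣ℤ? d
... | yes _ = 0ℤ
... | no _ with Any.any? (λ y → (+ p) ∣ℤ? ((+ y) * (+ y) - d)) (upTo p)
...   | yes _ = 1ℤ
...   | no _ = -1ℤ

-- f = a x^2 + b x + c (with a ≠ 0) is irreducible in ℤ[x]: it is nonzero,
-- not a unit, and in every factorisation f = g h one factor is a unit (±1).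
-- For a degree-2 polynomial a factorisation is either (constant d) · (quadratic)
-- or (linear) · (linear); linear polynomials are never units.
IrreducibleQuadratic : ℤ → ℤ → ℤ → Set
IrreducibleQuadratic a b c =
  (a ≢ 0ℤ) ×
  ((d a' b' c' : ℤ) → a ≡ d * a' → b ≡ d * b' → c ≡ d * c' → (d ≡ 1ℤ ⊎ d ≡ -1ℤ)) ×
  ((p q r s : ℤ) → a ≡ p * r → b ≡ p * s + q * r → c ≡ q * s → ⊥)

disc : ℤ → ℤ → ℤ → ℤ
disc a b c = b * b - (+ 4) * a * c

-- Multiplying f by 4a completes the square, 4a·f(x) = (2ax + b)² − D, and when p ∤ 2a the
-- substitution y = 2ax + b permutes the residues modulo p^k, so s(f, p^k) counts the square roots
-- of D modulo p^k; for p = 2 and b even, a·f(x) = (ax + b/2)² − D/4 plays the same role.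
-- If p^2h divides the constant, every square root modulo p^(2h+e) is a multiple of p^h, whence
-- s(y² − p^2h U, p^(2h+e)) = p^h · s(y² − U, p^e). For odd p and a unit U the roots modulo p are
-- simple and lift uniquely (Hensel), so there are 2 or 0 of them according to the Legendre symbol;
-- modulo 2^k with k ≥ 3 an odd U has 4 square roots if U ≡ 1 (mod 8) and none otherwise, the base
-- cases being read off from the residue of U modulo 8. When p ∣ 2a and p ∤ b, f′(x) = 2ax + b is a
-- unit, so Hensel lifting gives s(f, p^k) = s(f, p), which is computed directly; when p divides
-- both a and b, primitivity of f rules out any root.

{-# OPTIONS --safe #-}
module Submission where

open import Defs
open import Data.Nat using (ℕ; _≤_; _<_; _^_; _/_; _∸_; suc; zero; z≤n; s≤s; NonZero)
  renaming (_*_ to _*ℕ_; _+_ to _+ℕ_)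
import Data.Nat as ℕ
import Data.Nat.Properties as ℕP
import Data.Nat.DivMod as ℕDM
import Data.Nat.Divisibility as ℕD
open import Data.Nat.Divisibility using () renaming (_∣_ to _∣ℕ_)
open import Data.Nat.Primality using (Prime; euclidsLemma; prime⇒irreducible; prime⇒nonZero; prime[2]; ¬prime[1])
open import Data.Nat.Coprimality using (Coprime; coprime-Bézout; coprime-divisor; coprime-factors; 1-coprimeTo)
open import Data.Nat.GCD using (module Bézout)
import Data.Nat.Tactic.RingSolver as ℕRing
open import Data.Integer using (ℤ; +_; -[1+_]; _+_; _*_; _-_; -_; ∣_∣; 0ℤ; 1ℤ; -1ℤ)
import Data.Integer.Properties as ℤP
open import Data.Integer.DivMod using (_%ℕ_; _/ℕ_; a≡a%ℕn+[a/ℕn]*n; n%ℕd<d)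
open import Data.Integer.Divisibility using (_∣_)
import Data.Integer.Divisibility.Signed as ℤS
open ℤS using (divides; ∣ᵤ⇒∣; ∣⇒∣ᵤ; ∣m∣n⇒∣m+n; ∣m∣n⇒∣m-n; ∣m+n∣m⇒∣n; ∣m+n∣n⇒∣m; ∣m⇒∣-m; ∣n⇒∣m*n; ∣m⇒∣m*n)
open import Data.Integer.Tactic.RingSolver using (solve-∀)
open import Data.List using (length; filter; upTo; applyUpTo)
import Data.List.Relation.Unary.Any as Any
open import Data.List.Membership.Propositional using (lose)
open import Data.List.Membership.Propositional.Properties using (∈-upTo⁺)
open import Data.Product using (_×_; _,_; proj₁; proj₂; Σ)
open import Data.Sum using (_⊎_; inj₁; inj₂)
open import Data.Empty using (⊥; ⊥-elim)
open import Relation.Nullary using (¬_; Dec; yes; no)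
open import Relation.Binary.PropositionalEquality hiding ([_])

∑< : ℕ → (ℕ → ℕ) → ℕ
∑< zero    f = 0
∑< (suc n) f = f 0 +ℕ ∑< n (λ i → f (suc i))

∑<-cong : ∀ n {f g : ℕ → ℕ} → (∀ i → i < n → f i ≡ g i) → ∑< n f ≡ ∑< n g
∑<-cong zero    h = refl
∑<-cong (suc n) h = cong₂ _+ℕ_ (h 0 (s≤s z≤n)) (∑<-cong n (λ i i<n → h (suc i) (s≤s i<n)))

∑<-zeros : ∀ n (f : ℕ → ℕ) → (∀ i → i < n → f i ≡ 0) → ∑< n f ≡ 0
∑<-zeros zero    f h = refl
∑<-zeros (suc n) f h =
  trans (cong (_+ℕ ∑< n (λ i → f (suc i))) (h 0 (s≤s z≤n))) (∑<-zeros n _ (λ i i<n → h (suc i) (s≤s i<n)))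

∑<-+ : ∀ n (f g : ℕ → ℕ) → ∑< n (λ i → f i +ℕ g i) ≡ ∑< n f +ℕ ∑< n g
∑<-+ zero    f g = refl
∑<-+ (suc n) f g = trans (cong (f 0 +ℕ g 0 +ℕ_) (∑<-+ n _ _)) (interchange (f 0) (g 0) _ _)
  where
  interchange : ∀ a b c d → (a +ℕ b) +ℕ (c +ℕ d) ≡ (a +ℕ c) +ℕ (b +ℕ d)
  interchange = ℕRing.solve-∀

∑<-const : ∀ n c → ∑< n (λ _ → c) ≡ n *ℕ c
∑<-const zero    c = refl
∑<-const (suc n) c = cong (c +ℕ_) (∑<-const n c)

∑<-* : ∀ n c (f : ℕ → ℕ) → ∑< n (λ i → c *ℕ f i) ≡ c *ℕ ∑< n f
∑<-* zero    c f = sym (ℕP.*-zeroʳ c)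
∑<-* (suc n) c f = trans (cong (c *ℕ f 0 +ℕ_) (∑<-* n c _)) (sym (ℕP.*-distribˡ-+ c (f 0) _))

∑<-++ : ∀ m n (f : ℕ → ℕ) → ∑< (m +ℕ n) f ≡ ∑< m f +ℕ ∑< n (λ i → f (m +ℕ i))
∑<-++ zero    n f = refl
∑<-++ (suc m) n f = trans (cong (f 0 +ℕ_) (∑<-++ m n _)) (sym (ℕP.+-assoc (f 0) _ _))

∑<-blocks : ∀ q n (f : ℕ → ℕ) → ∑< (q *ℕ n) f ≡ ∑< q (λ t → ∑< n (λ r → f (t *ℕ n +ℕ r)))
∑<-blocks zero    n f = refl
∑<-blocks (suc q) n f = trans (∑<-++ n (q *ℕ n) f) (cong (∑< n f +ℕ_)
  (trans (∑<-blocks q n _)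
         (∑<-cong q (λ t _ → ∑<-cong n (λ r _ → cong f (sym (ℕP.+-assoc n (t *ℕ n) r)))))))

∑<-swap : ∀ m n (f : ℕ → ℕ → ℕ) → ∑< m (λ i → ∑< n (f i)) ≡ ∑< n (λ j → ∑< m (λ i → f i j))
∑<-swap zero    n f = sym (∑<-zeros n _ (λ _ _ → refl))
∑<-swap (suc m) n f = trans (cong (∑< n (f 0) +ℕ_) (∑<-swap m n _)) (sym (∑<-+ n _ _))

∑<-single : ∀ n j (f : ℕ → ℕ) → j < n → f j ≡ 1 → (∀ i → i < n → i ≢ j → f i ≡ 0) → ∑< n f ≡ 1
∑<-single (suc n) zero f _ fj h =
  cong₂ _+ℕ_ fj (∑<-zeros n _ (λ i i<n → h (suc i) (s≤s i<n) (λ ())))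
∑<-single (suc n) (suc j) f (s≤s j<n) fj h =
  cong₂ _+ℕ_ (h 0 (s≤s z≤n) (λ ()))
             (∑<-single n j _ j<n fj (λ i i<n i≢j → h (suc i) (s≤s i<n) (λ e → i≢j (ℕP.suc-injective e))))

∑<-head : ∀ n .{{_ : NonZero n}} (f : ℕ → ℕ) → (∀ i → 0 < i → i < n → f i ≡ 0) → ∑< n f ≡ f 0
∑<-head (suc n) f h =
  trans (cong (f 0 +ℕ_) (∑<-zeros n _ (λ i i<n → h (suc i) (s≤s z≤n) (s≤s i<n)))) (ℕP.+-identityʳ (f 0))

∑<-periodic : ∀ q n (f : ℕ → ℕ) → (∀ s r → r < n → f (s *ℕ n +ℕ r) ≡ f r) → ∑< (q *ℕ n) f ≡ q *ℕ ∑< n f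
∑<-periodic q n f per =
  trans (∑<-blocks q n f) (trans (∑<-cong q (λ s _ → ∑<-cong n (per s))) (∑<-const q (∑< n f)))

∑<≡0⇒≡0 : ∀ n (f : ℕ → ℕ) → ∑< n f ≡ 0 → ∀ i → i < n → f i ≡ 0
∑<≡0⇒≡0 (suc n) f sum≡0 zero    _         = ℕP.m+n≡0⇒m≡0 (f 0) sum≡0
∑<≡0⇒≡0 (suc n) f sum≡0 (suc i) (s≤s i<n) = ∑<≡0⇒≡0 n _ (ℕP.m+n≡0⇒n≡0 (f 0) sum≡0) i i<n

𝟙 : ∀ {A : Set} → Dec A → ℕ
𝟙 (yes _) = 1
𝟙 (no _)  = 0

infix 4 _∣ᶻ_

_∣ᶻ_ : ℕ → ℤ → Set
M ∣ᶻ z = + M ℤS.∣ z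

[_∣_] : ℕ → ℤ → ℕ
[ M ∣ z ] = 𝟙 ((+ M) ∣ℤ? z)

roots : ℕ → (ℤ → ℤ) → ℕ
roots M g = ∑< M (λ x → [ M ∣ g (+ x) ])

[∣]-yes : ∀ {M z} → M ∣ᶻ z → [ M ∣ z ] ≡ 1
[∣]-yes {M} {z} h with (+ M) ∣ℤ? z
... | yes _ = refl
... | no ∤ = ⊥-elim (∤ (∣⇒∣ᵤ h))

[∣]-no : ∀ {M z} → ¬ M ∣ᶻ z → [ M ∣ z ] ≡ 0
[∣]-no {M} {z} h with (+ M) ∣ℤ? z
... | yes ∣ = ⊥-elim (h (∣ᵤ⇒∣ ∣))
... | no _ = refl

[∣]-cong : ∀ {M z M′ z′} → (M ∣ᶻ z → M′ ∣ᶻ z′) → (M′ ∣ᶻ z′ → M ∣ᶻ z) →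
           [ M ∣ z ] ≡ [ M′ ∣ z′ ]
[∣]-cong {M} {z} {M′} {z′} f g with (+ M) ∣ℤ? z | (+ M′) ∣ℤ? z′
... | yes _ | yes _ = refl
... | yes h | no ∤′ = ⊥-elim (∤′ (∣⇒∣ᵤ (f (∣ᵤ⇒∣ h))))
... | no ∤  | yes h′ = ⊥-elim (∤ (∣⇒∣ᵤ (g (∣ᵤ⇒∣ h′))))
... | no _  | no _ = refl

[∣]≡0⇒∤ : ∀ {M z} → [ M ∣ z ] ≡ 0 → ¬ M ∣ᶻ z
[∣]≡0⇒∤ e h with trans (sym ([∣]-yes h)) e
... | ()

*[∣]-cong : ∀ M (x y : ℕ) z → (M ∣ᶻ z → x ≡ y) → x *ℕ [ M ∣ z ] ≡ y *ℕ [ M ∣ z ]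
*[∣]-cong M x y z h with (+ M) ∣ℤ? z
... | yes d = cong (_*ℕ 1) (h (∣ᵤ⇒∣ d))
... | no _  = trans (ℕP.*-zeroʳ x) (sym (ℕP.*-zeroʳ y))

roots≡0 : ∀ M g → (∀ x → ¬ M ∣ᶻ g (+ x)) → roots M g ≡ 0
roots≡0 M g h = ∑<-zeros M _ (λ x _ → [∣]-no (h x))

length-filter-applyUpTo : ∀ {P : ℕ → Set} (P? : ∀ x → Dec (P x)) n (f : ℕ → ℕ) →
  length (filter P? (applyUpTo f n)) ≡ ∑< n (λ i → 𝟙 (P? (f i)))
length-filter-applyUpTo P? zero    f = refl
length-filter-applyUpTo P? (suc n) f with P? (f 0)
... | yes _ = cong suc (length-filter-applyUpTo P? n (λ i → f (suc i)))
... | no _  = length-filter-applyUpTo P? n (λ i → f (suc i))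

numRoots≡roots : ∀ a b c m → numRoots a b c m ≡ roots m (quad a b c)
numRoots≡roots a b c m = length-filter-applyUpTo (λ x → (+ m) ∣ℤ? quad a b c (+ x)) m (λ i → i)

∣ᶻ-respʳ : ∀ {M x y} → x ≡ y → M ∣ᶻ x → M ∣ᶻ y
∣ᶻ-respʳ refl h = h

∣ᶻ0 : ∀ M → M ∣ᶻ 0ℤ
∣ᶻ0 M = divides 0ℤ refl

1∣ᶻ : ∀ z → 1 ∣ᶻ z
1∣ᶻ z = divides z (sym (ℤP.*-identityʳ z))

∣ᶻ-refl : ∀ M → M ∣ᶻ + M
∣ᶻ-refl M = divides 1ℤ (sym (ℤP.*-identityˡ (+ M)))

∣ᶻ-multiple : ∀ M q → M ∣ᶻ q * + M
∣ᶻ-multiple M q = divides q refl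

∣ᶻ-weaken : ∀ {K M x} → K ∣ℕ M → M ∣ᶻ x → K ∣ᶻ x
∣ᶻ-weaken K∣M = ℤS.∣-trans (∣ᵤ⇒∣ K∣M)

∣ᶻ-flip : ∀ {M} x y → M ∣ᶻ x - y → M ∣ᶻ y - x
∣ᶻ-flip x y h = ∣ᶻ-respʳ (negate x y) (∣m⇒∣-m h)
  where
  negate : ∀ x y → - (x - y) ≡ y - x
  negate = solve-∀

∣-0⇒∣ : ∀ {M U} → M ∣ᶻ U - + 0 → M ∣ᶻ U
∣-0⇒∣ {M} {U} = ∣ᶻ-respʳ (ℤP.+-identityʳ U)

∤⇒∤ᶻ : ∀ {M z} → ¬ (+ M) ∣ z → ¬ M ∣ᶻ z
∤⇒∤ᶻ ∤ h = ∤ (∣⇒∣ᵤ h)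

∣ᶻ-*-cancelʳ : ∀ K M .{{_ : NonZero M}} Y → (K *ℕ M) ∣ᶻ Y * + M → K ∣ᶻ Y
∣ᶻ-*-cancelʳ K M Y h = ℤS.*-cancelʳ-∣ (+ M) (subst (ℤS._∣ Y * + M) (ℤP.pos-* K M) h)

∣ᶻ-*-monoʳ : ∀ K M Y → K ∣ᶻ Y → (K *ℕ M) ∣ᶻ Y * + M
∣ᶻ-*-monoʳ K M Y h = subst (ℤS._∣ Y * + M) (sym (ℤP.pos-* K M)) (ℤS.*-monoˡ-∣ (+ M) h)

p∣p^[1+k] : ∀ p k → p ∣ℕ p ^ suc k
p∣p^[1+k] p k = ℕD.m∣m*n (p ^ k)

+[q*M+r] : ∀ q M r → + (q *ℕ M +ℕ r) ≡ + q * + M + + r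
+[q*M+r] q M r = trans (ℤP.pos-+ (q *ℕ M) r) (cong (_+ + r) (ℤP.pos-* q M))

[∣]-+multiple : ∀ M X Q → [ M ∣ X + Q * + M ] ≡ [ M ∣ X ]
[∣]-+multiple M X Q = [∣]-cong {M} {X + Q * + M} {M} {X} (λ d → ∣m+n∣n⇒∣m d (∣ᶻ-multiple M Q))
                                                         (λ d → ∣m∣n⇒∣m+n d (∣ᶻ-multiple M Q))

[∣]-split : ∀ {M z x y} → (M ∣ᶻ z → M ∣ᶻ x ⊎ M ∣ᶻ y) → (M ∣ᶻ x → M ∣ᶻ z) → (M ∣ᶻ y → M ∣ᶻ z) →
            (M ∣ᶻ x → ¬ M ∣ᶻ y) → [ M ∣ z ] ≡ [ M ∣ x ] +ℕ [ M ∣ y ]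
[∣]-split {M} {z} {x} {y} split x⇒z y⇒z disjoint with (+ M) ℤS.∣? x | (+ M) ℤS.∣? y
... | yes dx | yes dy = ⊥-elim (disjoint dx dy)
... | yes dx | no ∤y  = trans ([∣]-yes (x⇒z dx)) (sym (cong₂ _+ℕ_ ([∣]-yes dx) ([∣]-no ∤y)))
... | no ∤x  | yes dy = trans ([∣]-yes (y⇒z dy)) (sym (cong₂ _+ℕ_ ([∣]-no ∤x) ([∣]-yes dy)))
... | no ∤x  | no ∤y  = trans ([∣]-no neither) (sym (cong₂ _+ℕ_ ([∣]-no ∤x) ([∣]-no ∤y)))
  where
  neither : ¬ M ∣ᶻ z
  neither d with split d
  ... | inj₁ dx = ∤x dx
  ... | inj₂ dy = ∤y dy

roots-1 : ∀ g → roots 1 g ≡ 1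
roots-1 g = cong (_+ℕ 0) ([∣]-yes (1∣ᶻ (g (+ 0))))

residue : ∀ M .{{_ : NonZero M}} (z : ℤ) → Σ ℕ λ t → t < M × M ∣ᶻ + t - z
residue M z = z %ℕ M , n%ℕd<d z M , divides (- q) (begin
  r - z              ≡⟨ cong (λ w → r - w) (a≡a%ℕn+[a/ℕn]*n z M) ⟩
  r - (r + q * + M)  ≡⟨ cancel r q (+ M) ⟩
  - q * + M          ∎)
  where
  open ≡-Reasoning
  r = + (z %ℕ M)
  q = z /ℕ M
  cancel : ∀ r q m → r - (r + q * m) ≡ - q * m
  cancel = solve-∀

residue-unique-≤ : ∀ {M a b} → b ≤ a → a < M → M ∣ᶻ + a - + b → a ≡ b
residue-unique-≤ {M} {a} {b} b≤a a<M h =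
  ℕP.≤-antisym (ℕP.m∸n≡0⇒m≤n (small (ℕP.≤-<-trans (ℕP.m∸n≤m a b) a<M) M∣a∸b)) b≤a
  where
  M∣a∸b : M ∣ℕ a ∸ b
  M∣a∸b = subst (M ∣ℕ_) (cong ∣_∣ (trans (ℤP.[+m]-[+n]≡m⊖n a b) (ℤP.⊖-≥ b≤a))) (∣⇒∣ᵤ h)
  small : ∀ {d} → d < M → M ∣ℕ d → d ≡ 0
  small {zero}  _   _   = refl
  small {suc d} d<M M∣d = ⊥-elim (ℕP.<⇒≱ d<M (ℕD.∣⇒≤ M∣d))

residue-unique : ∀ {M a b} → a < M → b < M → M ∣ᶻ + a - + b → a ≡ b
residue-unique {M} {a} {b} a<M b<M h with ℕP.≤-total b a
... | inj₁ b≤a = residue-unique-≤ b≤a a<M h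
... | inj₂ a≤b = sym (residue-unique-≤ a≤b b<M (∣ᶻ-flip (+ a) (+ b) h))

prime∣*⇒∣⊎∣ : ∀ {p} → Prime p → ∀ x y → p ∣ᶻ x * y → p ∣ᶻ x ⊎ p ∣ᶻ y
prime∣*⇒∣⊎∣ {p} pr x y h with euclidsLemma ∣ x ∣ ∣ y ∣ pr (subst (p ∣ℕ_) (ℤP.abs-* x y) (∣⇒∣ᵤ h))
... | inj₁ p∣x = inj₁ (∣ᵤ⇒∣ p∣x)
... | inj₂ p∣y = inj₂ (∣ᵤ⇒∣ p∣y)

prime∣²⇒∣ : ∀ {p} → Prime p → ∀ x → p ∣ᶻ x * x → p ∣ᶻ x
prime∣²⇒∣ pr x h with prime∣*⇒∣⊎∣ pr x x h
... | inj₁ p∣x = p∣x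
... | inj₂ p∣x = p∣x

prime∤⇒coprime : ∀ {p n} → Prime p → ¬ p ∣ℕ n → Coprime p n
prime∤⇒coprime pr p∤n (d∣p , d∣n) with prime⇒irreducible pr d∣p
... | inj₁ d≡1 = d≡1
... | inj₂ refl = ⊥-elim (p∤n d∣n)

prime∤⇒coprime-^ : ∀ {p n} → Prime p → ¬ p ∣ℕ n → ∀ k → Coprime (p ^ k) n
prime∤⇒coprime-^ pr p∤n zero = 1-coprimeTo _
prime∤⇒coprime-^ pr p∤n (suc k) (d∣p^[1+k] , d∣n) =
  prime∤⇒coprime-^ pr p∤n k
    (coprime-factors (λ (d∣n , d∣p) → prime∤⇒coprime pr p∤n (d∣p , d∣n))
                     (ℕD.∣-trans d∣n (ℕD.m∣m*n _) , d∣p^[1+k]) , d∣n)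

prime∤-cancelˡ : ∀ {p} → Prime p → ∀ {B} → ¬ p ∣ᶻ B → ∀ k {X} → (p ^ k) ∣ᶻ B * X → (p ^ k) ∣ᶻ X
prime∤-cancelˡ {p} pr {B} p∤B k {X} h =
  ∣ᵤ⇒∣ (coprime-divisor (prime∤⇒coprime-^ pr (λ u → p∤B (∣ᵤ⇒∣ u)) k)
                        (subst ((p ^ k) ∣ℕ_) (ℤP.abs-* B X) (∣⇒∣ᵤ h)))

pos-1+*≡* : ∀ {a b c d} → 1 +ℕ a *ℕ b ≡ c *ℕ d → 1ℤ + + a * + b ≡ + c * + d
pos-1+*≡* {a} {b} {c} {d} e =
  trans (cong (λ w → 1ℤ + w) (sym (ℤP.pos-* a b))) (trans (cong +_ e) (ℤP.pos-* c d))

inverse-mod-ℕ : ∀ {P n} → Coprime P n → Σ ℤ λ u → P ∣ᶻ u * + n - 1ℤ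
inverse-mod-ℕ {P} {n} c with coprime-Bézout c
... | Bézout.+- x y eq = - + y , divides (- + x) (begin
  (- + y) * + n - 1ℤ   ≡⟨ negate (+ y) (+ n) ⟩
  - (1ℤ + + y * + n)   ≡⟨ cong -_ (pos-1+*≡* {y} {n} {x} {P} eq) ⟩
  - (+ x * + P)        ≡⟨ ℤP.neg-distribˡ-* (+ x) (+ P) ⟩
  - + x * + P          ∎)
  where
  open ≡-Reasoning
  negate : ∀ y n → (- y) * n - 1ℤ ≡ - (1ℤ + y * n)
  negate = solve-∀
... | Bézout.-+ x y eq = + y , divides (+ x) (begin
  + y * + n - 1ℤ         ≡⟨ cong (λ w → w - 1ℤ) (sym (pos-1+*≡* {x} {P} {y} {n} eq)) ⟩
  1ℤ + + x * + P - 1ℤ    ≡⟨ cancel (+ x * + P) ⟩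
  + x * + P              ∎)
  where
  open ≡-Reasoning
  cancel : ∀ z → 1ℤ + z - 1ℤ ≡ z
  cancel = solve-∀

inverse-mod-^ : ∀ {p} → Prime p → ∀ {B} → ¬ p ∣ᶻ B → ∀ k → Σ ℤ λ u → (p ^ k) ∣ᶻ u * B - 1ℤ
inverse-mod-^ {p} pr {B} p∤B k =
  sign-cases B (inverse-mod-ℕ (prime∤⇒coprime-^ pr (λ u → p∤B (∣ᵤ⇒∣ u)) k))
  where
  sign-cases : ∀ B → Σ ℤ (λ u → (p ^ k) ∣ᶻ u * + ∣ B ∣ - 1ℤ) → Σ ℤ λ u → (p ^ k) ∣ᶻ u * B - 1ℤ
  sign-cases (+ n)    inv     = inv
  sign-cases -[1+ n ] (u , h) = - u , ∣ᶻ-respʳ (neg² u (+ suc n)) h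
    where
    neg² : ∀ u m → u * m - 1ℤ ≡ (- u) * (- m) - 1ℤ
    neg² = solve-∀

-- The root is t ≡ −uA, u being an inverse of B modulo M.
roots-linear : ∀ M .{{_ : NonZero M}} (A B u : ℤ) → M ∣ᶻ u * B - 1ℤ →
               ∑< M (λ t → [ M ∣ A + B * + t ]) ≡ 1
roots-linear M A B u inv with residue M (- (u * A))
... | t₀ , t₀<M , t₀≡-uA =
  ∑<-single M t₀ _ t₀<M ([∣]-yes root)
    (λ t t<M t≢t₀ → [∣]-no (λ h → t≢t₀ (residue-unique t<M t₀<M (unique t h))))
  where
  e₁ : ∀ A B u t → A + B * t ≡ (- (u * B - 1ℤ)) * A + B * (t - (- (u * A)))
  e₁ = solve-∀
  root : M ∣ᶻ A + B * + t₀
  root = ∣ᶻ-respʳ (sym (e₁ A B u (+ t₀))) (∣m∣n⇒∣m+n (∣m⇒∣m*n A (∣m⇒∣-m inv)) (∣n⇒∣m*n B t₀≡-uA))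
  e₂ : ∀ A B u t t₀ → t - t₀ ≡ u * (A + B * t) - (t₀ - (- (u * A))) - (u * B - 1ℤ) * t
  e₂ = solve-∀
  unique : ∀ t → M ∣ᶻ A + B * + t → M ∣ᶻ + t - + t₀
  unique t h = ∣ᶻ-respʳ (sym (e₂ A B u (+ t) (+ t₀)))
                 (∣m∣n⇒∣m-n (∣m∣n⇒∣m-n (∣n⇒∣m*n u h) t₀≡-uA) (∣m⇒∣m*n (+ t) inv))

-- Double counting of the pairs (x, y) with y ≡ Bx + C (mod M): each x has exactly one such y and
-- each y exactly one such x.
∑<-affine-substitution : ∀ M .{{_ : NonZero M}} (P : ℤ → ℕ) (B C u : ℤ) → M ∣ᶻ u * B - 1ℤ →
  (∀ y y′ → M ∣ᶻ y - y′ → P y ≡ P y′) →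
  ∑< M (λ x → P (B * + x + C)) ≡ ∑< M (λ y → P (+ y))
∑<-affine-substitution M P B C u inv P-periodic = begin
  ∑< M (λ x → P (Bx+C x))
    ≡⟨ ∑<-cong M (λ x _ → sym (trans (cong (P (Bx+C x) *ℕ_) (roots-linear M (- Bx+C x) 1ℤ 1ℤ (∣ᶻ0 M)))
                                     (ℕP.*-identityʳ _))) ⟩
  ∑< M (λ x → P (Bx+C x) *ℕ ∑< M (λ y → [ M ∣ y-Bx-C x y ]))
    ≡⟨ ∑<-cong M (λ x _ → sym (∑<-* M (P (Bx+C x)) _)) ⟩
  ∑< M (λ x → ∑< M (λ y → P (Bx+C x) *ℕ [ M ∣ y-Bx-C x y ]))
    ≡⟨ ∑<-cong M (λ x _ → ∑<-cong M (λ y _ → *[∣]-cong M _ _ _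
         (λ h → P-periodic _ _ (∣ᶻ-respʳ (e₁ (Bx+C x) (+ y)) (∣m⇒∣-m h))))) ⟩
  ∑< M (λ x → ∑< M (λ y → P (+ y) *ℕ [ M ∣ y-Bx-C x y ]))
    ≡⟨ ∑<-swap M M _ ⟩
  ∑< M (λ y → ∑< M (λ x → P (+ y) *ℕ [ M ∣ y-Bx-C x y ]))
    ≡⟨ ∑<-cong M (λ y _ → ∑<-* M (P (+ y)) _) ⟩
  ∑< M (λ y → P (+ y) *ℕ ∑< M (λ x → [ M ∣ y-Bx-C x y ]))
    ≡⟨ ∑<-cong M (λ y _ → cong (P (+ y) *ℕ_) (trans
         (∑<-cong M (λ x _ → cong [ M ∣_] (e₂ B C (+ x) (+ y))))
         (roots-linear M (+ y - C) (- B) (- u) (∣ᶻ-respʳ (e₃ u B) inv)))) ⟩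
  ∑< M (λ y → P (+ y) *ℕ 1)
    ≡⟨ ∑<-cong M (λ y _ → ℕP.*-identityʳ _) ⟩
  ∑< M (λ y → P (+ y)) ∎
  where
  open ≡-Reasoning
  Bx+C : ℕ → ℤ
  Bx+C x = B * + x + C
  y-Bx-C : ℕ → ℕ → ℤ
  y-Bx-C x y = - Bx+C x + 1ℤ * + y
  e₁ : ∀ w y → - (- w + 1ℤ * y) ≡ w - y
  e₁ = solve-∀
  e₂ : ∀ B C x y → - (B * x + C) + 1ℤ * y ≡ (y - C) + (- B) * x
  e₂ = solve-∀
  e₃ : ∀ u B → u * B - 1ℤ ≡ (- u) * (- B) - 1ℤ
  e₃ = solve-∀

-- Completing the square

X²-_ : ℤ → ℤ → ℤ
(X²- U) y = y * y - U

[∣]-X²-cong : ∀ M E y y′ → M ∣ᶻ y - y′ → [ M ∣ (X²- E) y ] ≡ [ M ∣ (X²- E) y′ ]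
[∣]-X²-cong M E y y′ h =
  [∣]-cong (λ d → ∣ᶻ-respʳ (e₁ y y′ E) (∣m∣n⇒∣m-n d (∣m⇒∣m*n (y + y′) h)))
           (λ d → ∣ᶻ-respʳ (e₂ y y′ E) (∣m∣n⇒∣m+n d (∣m⇒∣m*n (y + y′) h)))
  where
  e₁ : ∀ y y′ E → (y * y - E) - (y - y′) * (y + y′) ≡ y′ * y′ - E
  e₁ = solve-∀
  e₂ : ∀ y y′ E → (y′ * y′ - E) + (y - y′) * (y + y′) ≡ y * y - E
  e₂ = solve-∀

roots-complete-square : ∀ {p} → Prime p → ∀ (g : ℤ → ℤ) B′ B C E → ¬ p ∣ᶻ B′ → ¬ p ∣ᶻ B →
  (∀ x → B′ * g x ≡ (X²- E) (B * x + C)) → ∀ k → roots (p ^ k) g ≡ roots (p ^ k) (X²- E)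
roots-complete-square {p} pr g B′ B C E p∤B′ p∤B square k =
  trans (∑<-cong M (λ x _ → [∣]-cong (λ d → ∣ᶻ-respʳ (square (+ x)) (∣n⇒∣m*n B′ d))
                                      (λ d → prime∤-cancelˡ pr p∤B′ k (∣ᶻ-respʳ (sym (square (+ x))) d))))
        (∑<-affine-substitution M (λ y → [ M ∣ (X²- E) y ]) B C (proj₁ inv) (proj₂ inv) ([∣]-X²-cong M E))
  where
  M = p ^ k
  instance
    _ : NonZero p
    _ = prime⇒nonZero pr
    _ : NonZero M
    _ = ℕP.m^n≢0 p k
  inv = inverse-mod-^ pr p∤B k

-- Hensel lifting of simple roots

-- Write x = r + tM. If M ∤ g(r) no lift of r is a root; if g(r) = wM then g(r + tM)/M ≡ w + g′(r)t
-- (mod p), a linear congruence in t with exactly one solution.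
roots-hensel : ∀ {p} → Prime p → ∀ (α β γ : ℤ) j →
  (∀ x → (p ^ suc j) ∣ᶻ quad α β γ x → ¬ p ∣ᶻ (+ 2) * α * x + β) →
  roots (p ^ suc (suc j)) (quad α β γ) ≡ roots (p ^ suc j) (quad α β γ)
roots-hensel {p} pr α β γ j simple = begin
  ∑< (p *ℕ M) (λ x → [ p *ℕ M ∣ g (+ x) ])
    ≡⟨ ∑<-blocks p M _ ⟩
  ∑< p (λ t → ∑< M (λ r → [ p *ℕ M ∣ g (+ (t *ℕ M +ℕ r)) ]))
    ≡⟨ ∑<-swap p M _ ⟩
  ∑< M (λ r → ∑< p (λ t → [ p *ℕ M ∣ g (+ (t *ℕ M +ℕ r)) ]))
    ≡⟨ ∑<-cong M (λ r _ → lifts r) ⟩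
  ∑< M (λ r → [ M ∣ g (+ r) ]) ∎
  where
  open ≡-Reasoning
  instance
    _ : NonZero p
    _ = prime⇒nonZero pr
    _ : NonZero (p ^ suc j)
    _ = ℕP.m^n≢0 p (suc j)
  M = p ^ suc j
  g = quad α β γ
  taylor : ∀ α β γ x T → α * (T + x) * (T + x) + β * (T + x) + γ ≡
                         (α * x * x + β * x + γ) + T * ((+ 2) * α * x + β + α * T)
  taylor = solve-∀
  expand : ∀ t r → g (+ (t *ℕ M +ℕ r)) ≡ g (+ r) + + t * + M * ((+ 2) * α * + r + β + α * (+ t * + M))
  expand t r = trans (cong g (+[q*M+r] t M r)) (taylor α β γ (+ r) (+ t * + M))
  lifts : ∀ r → ∑< p (λ t → [ p *ℕ M ∣ g (+ (t *ℕ M +ℕ r)) ]) ≡ [ M ∣ g (+ r) ]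
  lifts r with (+ M) ℤS.∣? g (+ r)
  ... | no ∤ = trans (∑<-zeros p _ (λ t _ → [∣]-no (λ d → ∤ (descend t (∣ᶻ-weaken (ℕD.n∣m*n p) d)))))
                     (sym ([∣]-no ∤))
    where
    cancel : ∀ a t m z → a + t * m * z - t * m * z ≡ a
    cancel = solve-∀
    descend : ∀ t → M ∣ᶻ g (+ (t *ℕ M +ℕ r)) → M ∣ᶻ g (+ r)
    descend t d = ∣ᶻ-respʳ (cancel (g (+ r)) (+ t) (+ M) _)
                    (∣m∣n⇒∣m-n (∣ᶻ-respʳ (expand t r) d) (∣m⇒∣m*n _ (∣n⇒∣m*n (+ t) (∣ᶻ-refl M))))
  ... | yes (divides w g[r]≡wM) =
    trans (∑<-cong p (λ t _ → [∣]-cong (lift⇒ t) (⇒lift t)))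
          (trans (roots-linear p w g′ u (∣ᶻ-weaken (p∣p^[1+k] p 0) inv)) (sym ([∣]-yes (divides w g[r]≡wM))))
    where
    g′ = (+ 2) * α * + r + β
    u = proj₁ (inverse-mod-^ pr (simple (+ r) (divides w g[r]≡wM)) 1)
    inv = proj₂ (inverse-mod-^ pr (simple (+ r) (divides w g[r]≡wM)) 1)
    Q Y : ℕ → ℤ
    Q t = α * + t * + t * + (p ^ j)
    Y t = w + g′ * + t + Q t * + p
    regroup : ∀ w t p m d α → w * (p * m) + t * (p * m) * (d + α * (t * (p * m))) ≡
                              (w + d * t + (α * t * t * m) * p) * (p * m)
    regroup = solve-∀
    factor : ∀ t → g (+ (t *ℕ M +ℕ r)) ≡ Y t * + M
    factor t = begin
      g (+ (t *ℕ M +ℕ r))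
        ≡⟨ expand t r ⟩
      g (+ r) + + t * + M * (g′ + α * (+ t * + M))
        ≡⟨ cong (λ z → z + + t * + M * (g′ + α * (+ t * + M))) g[r]≡wM ⟩
      w * + M + + t * + M * (g′ + α * (+ t * + M))
        ≡⟨ cong (λ m → w * m + + t * m * (g′ + α * (+ t * m))) (ℤP.pos-* p (p ^ j)) ⟩
      w * (+ p * + (p ^ j)) + + t * (+ p * + (p ^ j)) * (g′ + α * (+ t * (+ p * + (p ^ j))))
        ≡⟨ regroup w (+ t) (+ p) (+ (p ^ j)) g′ α ⟩
      Y t * (+ p * + (p ^ j))
        ≡⟨ cong (Y t *_) (sym (ℤP.pos-* p (p ^ j))) ⟩
      Y t * + M ∎
    cancel : ∀ a b q → a + b * q - b * q ≡ a
    cancel = solve-∀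
    lift⇒ : ∀ t → (p *ℕ M) ∣ᶻ g (+ (t *ℕ M +ℕ r)) → p ∣ᶻ w + g′ * + t
    lift⇒ t h = ∣ᶻ-respʳ (cancel (w + g′ * + t) (Q t) (+ p))
                  (∣m∣n⇒∣m-n (∣ᶻ-*-cancelʳ p M (Y t) (∣ᶻ-respʳ (factor t) h)) (∣ᶻ-multiple p (Q t)))
    ⇒lift : ∀ t → p ∣ᶻ w + g′ * + t → (p *ℕ M) ∣ᶻ g (+ (t *ℕ M +ℕ r))
    ⇒lift t h = ∣ᶻ-respʳ (sym (factor t)) (∣ᶻ-*-monoʳ p M (Y t) (∣m∣n⇒∣m+n h (∣ᶻ-multiple p (Q t))))

-- Removing an even power of p from the constant term

prime^[h+h]∣²⇒^h∣ : ∀ {p} → Prime p → ∀ h y → (p ^ (h +ℕ h)) ∣ᶻ y * y → (p ^ h) ∣ᶻ y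
prime^[h+h]∣²⇒^h∣ pr zero y _ = 1∣ᶻ y
prime^[h+h]∣²⇒^h∣ {p} pr (suc h) y d with prime∣²⇒∣ pr y (∣ᶻ-weaken (p∣p^[1+k] p (h +ℕ suc h)) d)
... | divides z refl = subst (_∣ᶻ z * + p) (ℕP.*-comm (p ^ h) p) (∣ᶻ-*-monoʳ (p ^ h) p z p^h∣z)
  where
  instance
    _ : NonZero (p *ℕ p)
    _ = ℕP.m*n≢0 p p {{prime⇒nonZero pr}} {{prime⇒nonZero pr}}
  p^[2+h+h] : p ^ (suc h +ℕ suc h) ≡ p ^ (h +ℕ h) *ℕ (p *ℕ p)
  p^[2+h+h] = trans (cong (λ e → p *ℕ p ^ e) (ℕP.+-suc h h)) (rearrange p (p ^ (h +ℕ h)))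
    where
    rearrange : ∀ p q → p *ℕ (p *ℕ q) ≡ q *ℕ (p *ℕ p)
    rearrange = ℕRing.solve-∀
  [zp]² : (z * + p) * (z * + p) ≡ (z * z) * + (p *ℕ p)
  [zp]² = trans (rearrange z (+ p)) (cong (z * z *_) (sym (ℤP.pos-* p p)))
    where
    rearrange : ∀ z p → (z * p) * (z * p) ≡ (z * z) * (p * p)
    rearrange = solve-∀
  p^h∣z : (p ^ h) ∣ᶻ z
  p^h∣z = prime^[h+h]∣²⇒^h∣ pr h z
    (∣ᶻ-*-cancelʳ (p ^ (h +ℕ h)) (p *ℕ p) (z * z) (subst (_∣ᶻ z * z * + (p *ℕ p)) p^[2+h+h] (∣ᶻ-respʳ [zp]² d)))

[∣]-X²-periodic : ∀ m U s r → [ m ∣ (X²- U) (+ (s *ℕ m +ℕ r)) ] ≡ [ m ∣ (X²- U) (+ r) ]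
[∣]-X²-periodic m U s r = [∣]-X²-cong m U (+ (s *ℕ m +ℕ r)) (+ r) (divides (+ s) (begin
  + (s *ℕ m +ℕ r) - + r   ≡⟨ cong (_- + r) (+[q*M+r] s m r) ⟩
  + s * + m + + r - + r   ≡⟨ cancel (+ s * + m) (+ r) ⟩
  + s * + m               ∎))
  where
  open ≡-Reasoning
  cancel : ∀ a b → a + b - b ≡ a
  cancel = solve-∀

X²-scaled-root⇒∣ : ∀ {p} → Prime p → ∀ h e U y →
  (p ^ (h +ℕ h +ℕ e)) ∣ᶻ (X²- (+ (p ^ (h +ℕ h)) * U)) y → (p ^ h) ∣ᶻ y
X²-scaled-root⇒∣ {p} pr h e U y d =
  prime^[h+h]∣²⇒^h∣ pr h y (∣ᶻ-respʳ (cancel (y * y) _) (∣m∣n⇒∣m+n d′ (∣m⇒∣m*n U (∣ᶻ-refl P))))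
  where
  P = p ^ (h +ℕ h)
  d′ : P ∣ᶻ (X²- (+ P * U)) y
  d′ = ∣ᶻ-weaken (subst (P ∣ℕ_) (sym (ℕP.^-distribˡ-+-* p (h +ℕ h) e)) (ℕD.m∣m*n (p ^ e))) d
  cancel : ∀ a b → a - b + b ≡ a
  cancel = solve-∀

[∣]-X²-rescale : ∀ m n .{{_ : NonZero n}} U t →
  [ m *ℕ (n *ℕ n) ∣ (X²- (+ (n *ℕ n) * U)) (+ (t *ℕ n)) ] ≡ [ m ∣ (X²- U) (+ t) ]
[∣]-X²-rescale m n U t = trans (cong [ m *ℕ (n *ℕ n) ∣_] factor)
  ([∣]-cong (∣ᶻ-*-cancelʳ m (n *ℕ n) ((X²- U) (+ t))) (∣ᶻ-*-monoʳ m (n *ℕ n) ((X²- U) (+ t))))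
  where
  instance
    _ : NonZero (n *ℕ n)
    _ = ℕP.m*n≢0 n n
  rearrange : ∀ t n U → (t * n) * (t * n) - (n * n) * U ≡ (t * t - U) * (n * n)
  rearrange = solve-∀
  factor : (X²- (+ (n *ℕ n) * U)) (+ (t *ℕ n)) ≡ (X²- U) (+ t) * + (n *ℕ n)
  factor = begin
    + (t *ℕ n) * + (t *ℕ n) - + (n *ℕ n) * U    ≡⟨ cong₂ (λ y P → y * y - P * U) (ℤP.pos-* t n) (ℤP.pos-* n n) ⟩
    (+ t * + n) * (+ t * + n) - (+ n * + n) * U  ≡⟨ rearrange (+ t) (+ n) U ⟩
    (X²- U) (+ t) * (+ n * + n)                  ≡⟨ cong ((X²- U) (+ t) *_) (sym (ℤP.pos-* n n)) ⟩
    (X²- U) (+ t) * + (n *ℕ n)                   ∎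
    where open ≡-Reasoning

-- The roots modulo p^(2h+e) are the multiples y = t p^h with p^e ∣ t² − U, and t ranges over
-- p^h periods of length p^e.
roots-X²-scaled : ∀ {p} → Prime p → ∀ {k E} h e U → k ≡ h +ℕ h +ℕ e → E ≡ + (p ^ (h +ℕ h)) * U →
                  roots (p ^ k) (X²- E) ≡ p ^ h *ℕ roots (p ^ e) (X²- U)
roots-X²-scaled {p} pr h e U refl refl = begin
  ∑< (p ^ K) (λ x → [ p ^ K ∣ G (+ x) ])
    ≡⟨ cong (λ B → ∑< B (λ x → [ p ^ K ∣ G (+ x) ])) p^K≡q*n ⟩
  ∑< (q *ℕ n) (λ x → [ p ^ K ∣ G (+ x) ])
    ≡⟨ ∑<-blocks q n _ ⟩
  ∑< q (λ t → ∑< n (λ r → [ p ^ K ∣ G (+ (t *ℕ n +ℕ r)) ]))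
    ≡⟨ ∑<-cong q (λ t _ → ∑<-head n _ (λ r 0<r r<n → [∣]-no (no-root t r 0<r r<n))) ⟩
  ∑< q (λ t → [ p ^ K ∣ G (+ (t *ℕ n +ℕ 0)) ])
    ≡⟨ ∑<-cong q (λ t _ → rescale t) ⟩
  ∑< q (λ t → [ m ∣ (X²- U) (+ t) ])
    ≡⟨ cong (λ B → ∑< B (λ t → [ m ∣ (X²- U) (+ t) ])) (ℕP.^-distribˡ-+-* p h e) ⟩
  ∑< (n *ℕ m) (λ t → [ m ∣ (X²- U) (+ t) ])
    ≡⟨ ∑<-periodic n m _ (λ s r _ → [∣]-X²-periodic m U s r) ⟩
  n *ℕ roots m (X²- U) ∎
  where
  open ≡-Reasoning
  K = h +ℕ h +ℕ e
  n = p ^ h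
  q = p ^ (h +ℕ e)
  m = p ^ e
  G = X²- (+ (p ^ (h +ℕ h)) * U)
  instance
    _ : NonZero n
    _ = ℕP.m^n≢0 p h {{prime⇒nonZero pr}}
  p^K≡q*n : p ^ K ≡ q *ℕ n
  p^K≡q*n = trans (cong (p ^_) (reorder h e)) (ℕP.^-distribˡ-+-* p (h +ℕ e) h)
    where
    reorder : ∀ h e → h +ℕ h +ℕ e ≡ h +ℕ e +ℕ h
    reorder = ℕRing.solve-∀
  p^[h+h]≡n*n : p ^ (h +ℕ h) ≡ n *ℕ n
  p^[h+h]≡n*n = ℕP.^-distribˡ-+-* p h h
  p^K≡m*[n*n] : p ^ K ≡ m *ℕ (n *ℕ n)
  p^K≡m*[n*n] = trans (ℕP.^-distribˡ-+-* p (h +ℕ h) e) (trans (ℕP.*-comm _ m) (cong (m *ℕ_) p^[h+h]≡n*n))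
  no-root : ∀ t r → 0 < r → r < n → ¬ (p ^ K) ∣ᶻ G (+ (t *ℕ n +ℕ r))
  no-root t r 0<r r<n d = ℕP.<⇒≢ 0<r (sym (residue-unique r<n (ℕ.>-nonZero⁻¹ n)
    (∣ᶻ-respʳ shift (∣m∣n⇒∣m-n (X²-scaled-root⇒∣ pr h e U (+ (t *ℕ n +ℕ r)) d) (∣ᶻ-multiple n (+ t))))))
    where
    cancel : ∀ a b → a + b - a ≡ b - + 0
    cancel = solve-∀
    shift : + (t *ℕ n +ℕ r) - + t * + n ≡ + r - + 0
    shift = trans (cong (_- + t * + n) (+[q*M+r] t n r)) (cancel (+ t * + n) (+ r))
  rescale : ∀ t → [ p ^ K ∣ G (+ (t *ℕ n +ℕ 0)) ] ≡ [ m ∣ (X²- U) (+ t) ]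
  rescale t = begin
    [ p ^ K ∣ G (+ (t *ℕ n +ℕ 0)) ]
      ≡⟨ cong (λ x → [ p ^ K ∣ G (+ x) ]) (ℕP.+-identityʳ (t *ℕ n)) ⟩
    [ p ^ K ∣ G (+ (t *ℕ n)) ]
      ≡⟨ cong₂ (λ M P → [ M ∣ (X²- (+ P * U)) (+ (t *ℕ n)) ]) p^K≡m*[n*n] p^[h+h]≡n*n ⟩
    [ m *ℕ (n *ℕ n) ∣ (X²- (+ (n *ℕ n) * U)) (+ (t *ℕ n)) ]
      ≡⟨ [∣]-X²-rescale m n U t ⟩
    [ m ∣ (X²- U) (+ t) ] ∎

-- Square roots modulo powers of an odd prime

roots-p-X²-multiple : ∀ {p} → Prime p → ∀ U → p ∣ᶻ U → roots (p ^ 1) (X²- U) ≡ 1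
roots-p-X²-multiple {p} pr U p∣U rewrite ℕP.*-identityʳ p =
  ∑<-single p 0 _ 0<p ([∣]-yes (∣ᶻ-respʳ (e₀ U) (∣m⇒∣-m p∣U)))
    (λ i i<p i≢0 → [∣]-no {p} {(X²- U) (+ i)} (λ d → i≢0 (residue-unique i<p 0<p
      (∣ᶻ-respʳ (e₁ (+ i)) (prime∣²⇒∣ pr (+ i) (∣ᶻ-respʳ (e₂ (+ i) U) (∣m∣n⇒∣m+n d p∣U)))))))
  where
  instance
    _ : NonZero p
    _ = prime⇒nonZero pr
  0<p : 0 < p
  0<p = ℕ.>-nonZero⁻¹ p
  e₀ : ∀ U → - U ≡ + 0 * + 0 - U
  e₀ = solve-∀
  e₁ : ∀ i → i ≡ i - + 0
  e₁ = solve-∀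
  e₂ : ∀ i U → i * i - U + U ≡ i * i
  e₂ = solve-∀

roots-p-X²-square : ∀ {p} → Prime p → ¬ p ∣ᶻ + 2 → ∀ U → ¬ p ∣ᶻ U → ∀ r → p ∣ᶻ r * r - U →
                    roots (p ^ 1) (X²- U) ≡ 2
roots-p-X²-square {p} pr p∤2 U p∤U r r²≡U rewrite ℕP.*-identityʳ p =
  trans (∑<-cong p (λ t _ → [∣]-split (split t) (minus⇒ t) (plus⇒ t) (disjoint t)))
        (trans (∑<-+ p _ _) (cong₂ _+ℕ_ (roots-linear p (- r) 1ℤ 1ℤ (∣ᶻ0 p)) (roots-linear p r 1ℤ 1ℤ (∣ᶻ0 p))))
  where
  instance
    _ : NonZero p
    _ = prime⇒nonZero pr
  factor : ∀ t r U → t * t - U ≡ (- r + 1ℤ * t) * (r + 1ℤ * t) + (r * r - U)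
  factor = solve-∀
  cancel : ∀ a b → a + b - b ≡ a
  cancel = solve-∀
  split : ∀ t → p ∣ᶻ (X²- U) (+ t) → p ∣ᶻ - r + 1ℤ * + t ⊎ p ∣ᶻ r + 1ℤ * + t
  split t d = prime∣*⇒∣⊎∣ pr _ _
    (∣ᶻ-respʳ (cancel _ (r * r - U)) (∣m∣n⇒∣m-n (∣ᶻ-respʳ (factor (+ t) r U) d) r²≡U))
  minus⇒ : ∀ t → p ∣ᶻ - r + 1ℤ * + t → p ∣ᶻ (X²- U) (+ t)
  minus⇒ t d = ∣ᶻ-respʳ (sym (factor (+ t) r U)) (∣m∣n⇒∣m+n (∣m⇒∣m*n (r + 1ℤ * + t) d) r²≡U)
  plus⇒ : ∀ t → p ∣ᶻ r + 1ℤ * + t → p ∣ᶻ (X²- U) (+ t)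
  plus⇒ t d = ∣ᶻ-respʳ (sym (factor (+ t) r U)) (∣m∣n⇒∣m+n (∣n⇒∣m*n (- r + 1ℤ * + t) d) r²≡U)
  difference : ∀ r t → (r + 1ℤ * t) - (- r + 1ℤ * t) ≡ (+ 2) * r
  difference = solve-∀
  cancel′ : ∀ a U → a - (a - U) ≡ U
  cancel′ = solve-∀
  disjoint : ∀ t → p ∣ᶻ - r + 1ℤ * + t → p ∣ᶻ r + 1ℤ * + t → ⊥
  disjoint t d₋ d₊ with prime∣*⇒∣⊎∣ pr (+ 2) r (∣ᶻ-respʳ (difference r (+ t)) (∣m∣n⇒∣m-n d₊ d₋))
  ... | inj₁ p∣2 = p∤2 p∣2
  ... | inj₂ p∣r = p∤U (∣ᶻ-respʳ (cancel′ (r * r) U) (∣m∣n⇒∣m-n (∣n⇒∣m*n r p∣r) r²≡U))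

roots-quad≡roots-X² : ∀ M U → roots M (quad 1ℤ 0ℤ (- U)) ≡ roots M (X²- U)
roots-quad≡roots-X² M U = ∑<-cong M (λ x _ → cong [ M ∣_] (normalise (+ x) U))
  where
  normalise : ∀ x U → 1ℤ * x * x + 0ℤ * x + - U ≡ x * x - U
  normalise = solve-∀

roots-p^-X²-square : ∀ {p} → Prime p → ¬ p ∣ᶻ + 2 → ∀ U → ¬ p ∣ᶻ U → ∀ r → p ∣ᶻ r * r - U →
                     ∀ j → roots (p ^ suc j) (X²- U) ≡ 2
roots-p^-X²-square pr p∤2 U p∤U r r²≡U zero = roots-p-X²-square pr p∤2 U p∤U r r²≡U
roots-p^-X²-square {p} pr p∤2 U p∤U r r²≡U (suc j) = begin
  roots (p ^ suc (suc j)) (X²- U)            ≡⟨ sym (roots-quad≡roots-X² (p ^ suc (suc j)) U) ⟩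
  roots (p ^ suc (suc j)) (quad 1ℤ 0ℤ (- U)) ≡⟨ roots-hensel pr 1ℤ 0ℤ (- U) j simple ⟩
  roots (p ^ suc j) (quad 1ℤ 0ℤ (- U))       ≡⟨ roots-quad≡roots-X² (p ^ suc j) U ⟩
  roots (p ^ suc j) (X²- U)                  ≡⟨ roots-p^-X²-square pr p∤2 U p∤U r r²≡U j ⟩
  2                                          ∎
  where
  open ≡-Reasoning
  e₁ : ∀ x U → 1ℤ * x * x + 0ℤ * x + - U ≡ x * x - U
  e₁ = solve-∀
  e₂ : ∀ x → (+ 2) * 1ℤ * x + 0ℤ ≡ (+ 2) * x
  e₂ = solve-∀
  e₃ : ∀ a U → a - (a - U) ≡ U
  e₃ = solve-∀
  simple : ∀ x → (p ^ suc j) ∣ᶻ quad 1ℤ 0ℤ (- U) x → ¬ p ∣ᶻ (+ 2) * 1ℤ * x + 0ℤ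
  simple x d d′ with prime∣*⇒∣⊎∣ pr (+ 2) x (∣ᶻ-respʳ (e₂ x) d′)
  ... | inj₁ p∣2 = p∤2 p∣2
  ... | inj₂ p∣x = p∤U (∣ᶻ-respʳ (e₃ (x * x) U)
                     (∣m∣n⇒∣m-n (∣n⇒∣m*n x p∣x) (∣ᶻ-respʳ (e₁ x U) (∣ᶻ-weaken (p∣p^[1+k] p j) d))))

-- Square roots modulo powers of 2

roots-X²≡0⇒no-root : ∀ M .{{_ : NonZero M}} U → roots M (X²- U) ≡ 0 → ∀ y → ¬ M ∣ᶻ (X²- U) y
roots-X²≡0⇒no-root M U none y d with residue M y
... | t , t<M , t≡y = [∣]≡0⇒∤ (∑<≡0⇒≡0 M _ none t t<M)
                        (∣ᶻ-respʳ (sym (e (+ t) y U)) (∣m∣n⇒∣m+n d (∣m⇒∣m*n (+ t + y) t≡y)))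
  where
  e : ∀ t y U → t * t - U ≡ (y * y - U) + (t - y) * (t + y)
  e = solve-∀

roots-X²-const-cong : ∀ M U U′ → M ∣ᶻ U′ - U → roots M (X²- U) ≡ roots M (X²- U′)
roots-X²-const-cong M U U′ h = ∑<-cong M (λ x _ →
  [∣]-cong (λ d → ∣ᶻ-respʳ (e₁ (+ x) U U′) (∣m∣n⇒∣m-n d h))
           (λ d → ∣ᶻ-respʳ (e₂ (+ x) U U′) (∣m∣n⇒∣m+n d h)))
  where
  e₁ : ∀ y U U′ → (y * y - U) - (U′ - U) ≡ y * y - U′
  e₁ = solve-∀
  e₂ : ∀ y U U′ → (y * y - U′) + (U′ - U) ≡ y * y - U
  e₂ = solve-∀

roots-X²-by-residue : ∀ M .{{_ : NonZero M}} U n →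
  (∀ u → u < M → M ∣ᶻ + u - U → roots M (X²- (+ u)) ≡ n) → roots M (X²- U) ≡ n
roots-X²-by-residue M U n count with residue M U
... | u , u<M , u≡U = trans (roots-X²-const-cong M U (+ u) u≡U) (count u u<M u≡U)

roots-4-X²-1 : ∀ U → 4 ∣ᶻ U - 1ℤ → roots 4 (X²- U) ≡ 2
roots-4-X²-1 U h = roots-X²-const-cong 4 U 1ℤ (∣ᶻ-flip U 1ℤ h)

roots-4-X²-0 : ∀ U → ¬ 4 ∣ᶻ U → ¬ 4 ∣ᶻ U - 1ℤ → roots 4 (X²- U) ≡ 0
roots-4-X²-0 U 4∤U 4∤U-1 = roots-X²-by-residue 4 U 0 count
  where
  count : ∀ u → u < 4 → 4 ∣ᶻ + u - U → roots 4 (X²- (+ u)) ≡ 0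
  count 0 _ h = ⊥-elim (4∤U (∣-0⇒∣ (∣ᶻ-flip (+ 0) U h)))
  count 1 _ h = ⊥-elim (4∤U-1 (∣ᶻ-flip (+ 1) U h))
  count 2 _ _ = refl
  count 3 _ _ = refl
  count (suc (suc (suc (suc _)))) (s≤s (s≤s (s≤s (s≤s ())))) _

roots-8-X²-1 : ∀ U → 8 ∣ᶻ U - 1ℤ → roots 8 (X²- U) ≡ 4
roots-8-X²-1 U h = roots-X²-const-cong 8 U 1ℤ (∣ᶻ-flip U 1ℤ h)

roots-8-X²-0 : ∀ U → ¬ 4 ∣ᶻ U → ¬ 8 ∣ᶻ U - 1ℤ → roots 8 (X²- U) ≡ 0
roots-8-X²-0 U 4∤U 8∤U-1 = roots-X²-by-residue 8 U 0 count
  where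
  4∣8 : 4 ∣ℕ 8
  4∣8 = ℕD.divides 2 refl
  add4 : ∀ U → U - + 4 + + 4 ≡ U
  add4 = solve-∀
  count : ∀ u → u < 8 → 8 ∣ᶻ + u - U → roots 8 (X²- (+ u)) ≡ 0
  count 0 _ h = ⊥-elim (4∤U (∣-0⇒∣ (∣ᶻ-weaken 4∣8 (∣ᶻ-flip (+ 0) U h))))
  count 1 _ h = ⊥-elim (8∤U-1 (∣ᶻ-flip (+ 1) U h))
  count 2 _ _ = refl
  count 3 _ _ = refl
  count 4 _ h = ⊥-elim (4∤U (∣ᶻ-respʳ (add4 U) (∣m∣n⇒∣m+n (∣ᶻ-weaken 4∣8 (∣ᶻ-flip (+ 4) U h)) (∣ᶻ-refl 4))))
  count 5 _ _ = refl
  count 6 _ _ = refl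
  count 7 _ _ = refl
  count (suc (suc (suc (suc (suc (suc (suc (suc _)))))))) (s≤s (s≤s (s≤s (s≤s (s≤s (s≤s (s≤s (s≤s ())))))))) _

roots-2-X² : ∀ U → roots 2 (X²- U) ≡ 1
roots-2-X² U = roots-X²-by-residue 2 U 1 count
  where
  count : ∀ u → u < 2 → 2 ∣ᶻ + u - U → roots 2 (X²- (+ u)) ≡ 1
  count 0 _ _ = refl
  count 1 _ _ = refl
  count (suc (suc _)) (s≤s (s≤s ())) _

2∤1 : ¬ 2 ∣ᶻ 1ℤ
2∤1 = [∣]≡0⇒∤ refl

odd⇒2∣+1 : ∀ z → ¬ 2 ∣ᶻ z → 2 ∣ᶻ z + 1ℤ
odd⇒2∣+1 z 2∤z with residue 2 z
... | 0 , _ , h = ⊥-elim (2∤z (∣-0⇒∣ (∣ᶻ-flip (+ 0) z h)))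
... | 1 , _ , h = ∣ᶻ-respʳ (e z) (∣m∣n⇒∣m+n (∣ᶻ-flip (+ 1) z h) (∣ᶻ-refl 2))
  where
  e : ∀ z → z - + 1 + + 2 ≡ z + 1ℤ
  e = solve-∀
... | suc (suc _) , s≤s (s≤s ()) , _

[2∣]+[2∣+odd]≡1 : ∀ w r → ¬ 2 ∣ᶻ r → [ 2 ∣ w ] +ℕ [ 2 ∣ w + r ] ≡ 1
[2∣]+[2∣+odd]≡1 w r 2∤r with (+ 2) ℤS.∣? w
... | yes 2∣w = cong₂ _+ℕ_ ([∣]-yes 2∣w) ([∣]-no (λ 2∣w+r → 2∤r (∣m+n∣m⇒∣n 2∣w+r 2∣w)))
... | no 2∤w  = cong₂ _+ℕ_ ([∣]-no 2∤w)
  ([∣]-yes (∣ᶻ-respʳ (e w r) (∣m∣n⇒∣m-n (∣m∣n⇒∣m+n (odd⇒2∣+1 w 2∤w) (odd⇒2∣+1 r 2∤r)) (∣ᶻ-refl 2))))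
  where
  e : ∀ w r → w + 1ℤ + (r + 1ℤ) - + 2 ≡ w + r
  e = solve-∀

∑<-4-[2∣w+s*odd]≡2 : ∀ w r → ¬ 2 ∣ᶻ r → ∑< 4 (λ s → [ 2 ∣ w + + s * r ]) ≡ 2
∑<-4-[2∣w+s*odd]≡2 w r 2∤r = begin
  [ 2 ∣ w + + 0 * r ] +ℕ ([ 2 ∣ w + + 1 * r ] +ℕ ([ 2 ∣ w + + 2 * r ] +ℕ ([ 2 ∣ w + + 3 * r ] +ℕ 0)))
    ≡⟨ cong₂ (λ x y → x +ℕ (y +ℕ ([ 2 ∣ w + + 2 * r ] +ℕ ([ 2 ∣ w + + 3 * r ] +ℕ 0))))
             (cong [ 2 ∣_] (e₀ w r)) (cong [ 2 ∣_] (e₁ w r)) ⟩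
  [ 2 ∣ w ] +ℕ ([ 2 ∣ w + r ] +ℕ ([ 2 ∣ w + + 2 * r ] +ℕ ([ 2 ∣ w + + 3 * r ] +ℕ 0)))
    ≡⟨ cong₂ (λ x y → [ 2 ∣ w ] +ℕ ([ 2 ∣ w + r ] +ℕ (x +ℕ (y +ℕ 0))))
             (drop-2r w) (trans (cong [ 2 ∣_] (e₃ w r)) (drop-2r (w + r))) ⟩
  [ 2 ∣ w ] +ℕ ([ 2 ∣ w + r ] +ℕ ([ 2 ∣ w ] +ℕ ([ 2 ∣ w + r ] +ℕ 0)))
    ≡⟨ regroup [ 2 ∣ w ] [ 2 ∣ w + r ] ⟩
  ([ 2 ∣ w ] +ℕ [ 2 ∣ w + r ]) +ℕ ([ 2 ∣ w ] +ℕ [ 2 ∣ w + r ])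
    ≡⟨ cong (λ z → z +ℕ z) ([2∣]+[2∣+odd]≡1 w r 2∤r) ⟩
  2 ∎
  where
  open ≡-Reasoning
  e₀ : ∀ w r → w + + 0 * r ≡ w
  e₀ = solve-∀
  e₁ : ∀ w r → w + + 1 * r ≡ w + r
  e₁ = solve-∀
  e₃ : ∀ w r → w + + 3 * r ≡ (w + r) + + 2 * r
  e₃ = solve-∀
  drop-2r : ∀ z → [ 2 ∣ z + + 2 * r ] ≡ [ 2 ∣ z ]
  drop-2r z = [∣]-cong {2} {z + + 2 * r} {2} {z} (λ d → ∣m+n∣n⇒∣m d (∣m⇒∣m*n r (∣ᶻ-refl 2)))
                                                  (λ d → ∣m∣n⇒∣m+n d (∣m⇒∣m*n r (∣ᶻ-refl 2)))
  regroup : ∀ x y → x +ℕ (y +ℕ (x +ℕ (y +ℕ 0))) ≡ (x +ℕ y) +ℕ (x +ℕ y)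
  regroup = ℕRing.solve-∀

∑<-4-lifts : ∀ N .{{_ : NonZero N}} A r → (N ∣ᶻ A → ¬ 2 ∣ᶻ r) →
  ∑< 4 (λ s → [ 2 *ℕ N ∣ A + (+ s * r) * + N ]) ≡ 2 *ℕ [ N ∣ A ]
∑<-4-lifts N A r r-odd with (+ N) ℤS.∣? A
... | yes (divides w A≡wN) = begin
  ∑< 4 (λ s → [ 2 *ℕ N ∣ A + (+ s * r) * + N ])
    ≡⟨ ∑<-cong 4 (λ s _ → cong [ 2 *ℕ N ∣_] (trans (cong (_+ (+ s * r) * + N) A≡wN)
                                              (sym (ℤP.*-distribʳ-+ (+ N) w (+ s * r))))) ⟩
  ∑< 4 (λ s → [ 2 *ℕ N ∣ (w + + s * r) * + N ])
    ≡⟨ ∑<-cong 4 (λ s _ → [∣]-cong (∣ᶻ-*-cancelʳ 2 N (w + + s * r)) (∣ᶻ-*-monoʳ 2 N (w + + s * r))) ⟩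
  ∑< 4 (λ s → [ 2 ∣ w + + s * r ])
    ≡⟨ ∑<-4-[2∣w+s*odd]≡2 w r (r-odd (divides w A≡wN)) ⟩
  2
    ≡⟨ cong (2 *ℕ_) ([∣]-yes (divides w A≡wN)) ⟨
  2 *ℕ [ N ∣ A ] ∎
  where open ≡-Reasoning
... | no N∤A = trans (∑<-zeros 4 _ (λ s _ → [∣]-no {2 *ℕ N} {A + (+ s * r) * + N}
                       (λ d → N∤A (∣m+n∣n⇒∣m (∣ᶻ-weaken (ℕD.n∣m*n 2) d) (∣ᶻ-multiple N (+ s * r))))))
                   (sym (cong (2 *ℕ_) ([∣]-no N∤A)))

-- With M = 4m, (r + sM)² ≡ r² (mod 2M) and (r + sM)² ≡ r² + 2M·sr (mod 4M); a root r modulo 2M is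
-- odd, so it lifts to exactly two of the four residues r + sM modulo 4M. Both counts therefore equal
-- 2·#{r < M : 2M ∣ r² − U}.
roots-X²-odd-lift : ∀ m .{{_ : NonZero m}} U → ¬ 2 ∣ᶻ U →
  roots (2 *ℕ (2 *ℕ (2 *ℕ (2 *ℕ m)))) (X²- U) ≡ roots (2 *ℕ (2 *ℕ (2 *ℕ m))) (X²- U)
roots-X²-odd-lift m U 2∤U = trans roots-mod-4M (sym roots-mod-2M)
  where
  open ≡-Reasoning
  M = 2 *ℕ (2 *ℕ m)
  instance
    _ : NonZero (2 *ℕ M)
    _ = ℕP.m*n≢0 2 M {{_}} {{ℕP.m*n≢0 2 (2 *ℕ m) {{_}} {{ℕP.m*n≢0 2 m}}}}
  A : ℕ → ℤ
  A r = (X²- U) (+ r)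
  f₂ f₄ : ℕ → ℕ
  f₂ x = [ 2 *ℕ M ∣ A x ]
  f₄ x = [ 2 *ℕ (2 *ℕ M) ∣ A x ]
  +2* : ∀ n → + (2 *ℕ n) ≡ + 2 * + n
  +2* n = ℤP.pos-* 2 n
  +M : + M ≡ + 4 * + m
  +M = trans (+2* (2 *ℕ m)) (trans (cong (λ N → + 2 * N) (+2* m)) (double (+ 2) (+ m)))
    where
    double : ∀ a b → a * (a * b) ≡ (a * a) * b
    double = solve-∀
  +2M : + (2 *ℕ M) ≡ + 8 * + m
  +2M = trans (+2* M) (trans (cong (λ N → + 2 * N) +M) (sym (ℤP.*-assoc (+ 2) (+ 4) (+ m))))
  +4M : + (2 *ℕ (2 *ℕ M)) ≡ + 16 * + m
  +4M = trans (+2* (2 *ℕ M)) (trans (cong (λ N → + 2 * N) +2M) (sym (ℤP.*-assoc (+ 2) (+ 8) (+ m))))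
  +[sM+r] : ∀ s r → + (s *ℕ M +ℕ r) ≡ + s * (+ 4 * + m) + + r
  +[sM+r] s r = trans (+[q*M+r] s M r) (cong (λ N → + s * N + + r) +M)
  expand₂ : ∀ s r U m → (s * ((+ 4) * m) + r) * (s * ((+ 4) * m) + r) - U ≡
                        (r * r - U) + (s * r + (+ 2) * (s * s * m)) * ((+ 8) * m)
  expand₂ = solve-∀
  expand₄ : ∀ s r U m → (s * ((+ 4) * m) + r) * (s * ((+ 4) * m) + r) - U ≡
                        ((r * r - U) + (s * r) * ((+ 8) * m)) + (s * s * m) * ((+ 16) * m)
  expand₄ = solve-∀
  mod-2M : ∀ s r → [ 2 *ℕ M ∣ (X²- U) (+ (s *ℕ M +ℕ r)) ] ≡ [ 2 *ℕ M ∣ A r ]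
  mod-2M s r = trans (cong [ 2 *ℕ M ∣_] (begin
      (X²- U) (+ (s *ℕ M +ℕ r))
        ≡⟨ cong (X²- U) (+[sM+r] s r) ⟩
      (X²- U) (+ s * (+ 4 * + m) + + r)
        ≡⟨ expand₂ (+ s) (+ r) U (+ m) ⟩
      A r + (+ s * + r + + 2 * (+ s * + s * + m)) * (+ 8 * + m)
        ≡⟨ cong (λ N → A r + (+ s * + r + + 2 * (+ s * + s * + m)) * N) (sym +2M) ⟩
      A r + (+ s * + r + + 2 * (+ s * + s * + m)) * + (2 *ℕ M) ∎))
    ([∣]-+multiple (2 *ℕ M) (A r) (+ s * + r + + 2 * (+ s * + s * + m)))
  mod-4M : ∀ s r → [ 2 *ℕ (2 *ℕ M) ∣ (X²- U) (+ (s *ℕ M +ℕ r)) ] ≡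
                   [ 2 *ℕ (2 *ℕ M) ∣ A r + (+ s * + r) * + (2 *ℕ M) ]
  mod-4M s r = trans (cong [ 2 *ℕ (2 *ℕ M) ∣_] (begin
      (X²- U) (+ (s *ℕ M +ℕ r))
        ≡⟨ cong (X²- U) (+[sM+r] s r) ⟩
      (X²- U) (+ s * (+ 4 * + m) + + r)
        ≡⟨ expand₄ (+ s) (+ r) U (+ m) ⟩
      (A r + (+ s * + r) * (+ 8 * + m)) + (+ s * + s * + m) * (+ 16 * + m)
        ≡⟨ cong₂ (λ N N′ → (A r + (+ s * + r) * N) + (+ s * + s * + m) * N′) (sym +2M) (sym +4M) ⟩
      (A r + (+ s * + r) * + (2 *ℕ M)) + (+ s * + s * + m) * + (2 *ℕ (2 *ℕ M)) ∎))
    ([∣]-+multiple (2 *ℕ (2 *ℕ M)) (A r + (+ s * + r) * + (2 *ℕ M)) (+ s * + s * + m))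
  r-odd : ∀ r → (2 *ℕ M) ∣ᶻ A r → ¬ 2 ∣ᶻ + r
  r-odd r 2M∣Ar 2∣r = 2∤U (∣ᶻ-respʳ (cancel (+ r * + r) U)
                        (∣m∣n⇒∣m-n (∣n⇒∣m*n (+ r) 2∣r) (∣ᶻ-weaken (ℕD.m∣m*n M) 2M∣Ar)))
    where
    cancel : ∀ a U → a - (a - U) ≡ U
    cancel = solve-∀
  roots-mod-2M : roots (2 *ℕ M) (X²- U) ≡ ∑< M (λ r → 2 *ℕ [ 2 *ℕ M ∣ A r ])
  roots-mod-2M = trans (∑<-blocks 2 M f₂) (trans (∑<-swap 2 M (λ s r → f₂ (s *ℕ M +ℕ r)))
    (∑<-cong M (λ r _ → trans (∑<-cong 2 (λ s _ → mod-2M s r)) (∑<-const 2 (f₂ r)))))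
  roots-mod-4M : roots (2 *ℕ (2 *ℕ M)) (X²- U) ≡ ∑< M (λ r → 2 *ℕ [ 2 *ℕ M ∣ A r ])
  roots-mod-4M = trans (cong (λ B → ∑< B f₄) (quadruple M))
    (trans (∑<-blocks 4 M f₄) (trans (∑<-swap 4 M (λ s r → f₄ (s *ℕ M +ℕ r)))
    (∑<-cong M (λ r _ → trans (∑<-cong 4 (λ s _ → mod-4M s r)) (∑<-4-lifts (2 *ℕ M) (A r) (+ r) (r-odd r))))))
    where
    quadruple : ∀ M → 2 *ℕ (2 *ℕ M) ≡ 4 *ℕ M
    quadruple = ℕRing.solve-∀

roots-2^-X²-1mod8 : ∀ U → 8 ∣ᶻ U - 1ℤ → ∀ i → roots (2 ^ (3 +ℕ i)) (X²- U) ≡ 4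
roots-2^-X²-1mod8 U h zero    = roots-8-X²-1 U h
roots-2^-X²-1mod8 U h (suc i) = trans (roots-X²-odd-lift (2 ^ i) {{ℕP.m^n≢0 2 i}} U 2∤U) (roots-2^-X²-1mod8 U h i)
  where
  cancel : ∀ U → U - (U - 1ℤ) ≡ 1ℤ
  cancel = solve-∀
  2∤U : ¬ 2 ∣ᶻ U
  2∤U 2∣U = 2∤1 (∣ᶻ-respʳ (cancel U) (∣m∣n⇒∣m-n 2∣U (∣ᶻ-weaken (ℕD.divides 4 refl) h)))

legendre≡1⇒square : ∀ d p → legendre d p ≡ 1ℤ → Σ ℤ λ r → p ∣ᶻ r * r - d
legendre≡1⇒square d p e with (+ p) ∣ℤ? d
... | yes _ with e
...   | ()
legendre≡1⇒square d p e | no _ with Any.any? (λ y → (+ p) ∣ℤ? ((+ y) * (+ y) - d)) (upTo p)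
...   | yes sq = + proj₁ (Any.satisfied sq) , ∣ᵤ⇒∣ (proj₂ (Any.satisfied sq))
...   | no _ with e
...     | ()

legendre≡-1⇒nonsquare : ∀ d p .{{_ : NonZero p}} → legendre d p ≡ -1ℤ → ∀ z → ¬ p ∣ᶻ z * z - d
legendre≡-1⇒nonsquare d p e with (+ p) ∣ℤ? d
... | yes _ with e
...   | ()
legendre≡-1⇒nonsquare d p e | no _ with Any.any? (λ y → (+ p) ∣ℤ? ((+ y) * (+ y) - d)) (upTo p)
...   | yes _ with e
...     | ()
legendre≡-1⇒nonsquare d p e | no _ | no none = λ z h → let (t , t<p , t≡z) = residue p z in
  none (lose (∈-upTo⁺ t<p) (∣⇒∣ᵤ (∣ᶻ-respʳ (e₁ (+ t) z d) (∣m∣n⇒∣m+n h (∣m⇒∣m*n (+ t + z) t≡z)))))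
  where
  e₁ : ∀ t z d → z * z - d + (t - z) * (t + z) ≡ t * t - d
  e₁ = solve-∀

-- Counting square roots of p^l D modulo p^k

halve : ∀ k → Σ ℕ λ h → Σ ℕ λ e → e ≤ 1 × k ≡ h +ℕ h +ℕ e × k / 2 ≡ h
halve k = k / 2 , k ℕ.% 2 , ℕP.≤-pred (ℕDM.m%n<n k 2) ,
          trans (ℕDM.m≡m%n+[m/n]*n k 2) (reorder (k ℕ.% 2) (k / 2)) , refl
  where
  reorder : ∀ e h → e +ℕ h *ℕ 2 ≡ h +ℕ h +ℕ e
  reorder = ℕRing.solve-∀

+p^[m+n]* : ∀ p m n D → + (p ^ (m +ℕ n)) * D ≡ + (p ^ m) * (+ (p ^ n) * D)
+p^[m+n]* p m n D = trans (cong (_* D) (trans (cong +_ (ℕP.^-distribˡ-+-* p m n)) (ℤP.pos-* (p ^ m) (p ^ n))))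
                          (ℤP.*-assoc (+ (p ^ m)) (+ (p ^ n)) D)

roots-X²-p^[2h+e] : ∀ {p} → Prime p → ∀ h e U → e ≤ 1 → (p ^ e) ∣ᶻ U ⊎ p ≡ 2 →
                    roots (p ^ (h +ℕ h +ℕ e)) (X²- (+ (p ^ (h +ℕ h)) * U)) ≡ p ^ h
roots-X²-p^[2h+e] {p} pr h e U e≤1 p^e∣U = begin
  roots (p ^ (h +ℕ h +ℕ e)) (X²- (+ (p ^ (h +ℕ h)) * U))  ≡⟨ roots-X²-scaled pr h e U refl refl ⟩
  p ^ h *ℕ roots (p ^ e) (X²- U)                          ≡⟨ cong (p ^ h *ℕ_) (one e e≤1 p^e∣U) ⟩
  p ^ h *ℕ 1                                              ≡⟨ ℕP.*-identityʳ (p ^ h) ⟩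
  p ^ h                                                   ∎
  where
  open ≡-Reasoning
  one : ∀ e → e ≤ 1 → (p ^ e) ∣ᶻ U ⊎ p ≡ 2 → roots (p ^ e) (X²- U) ≡ 1
  one zero       _         _          = roots-1 (X²- U)
  one (suc zero) _         (inj₁ p∣U) = roots-p-X²-multiple pr U (∣ᶻ-weaken (ℕD.divides 1 (ℕP.*-comm p 1)) p∣U)
  one (suc zero) _         (inj₂ refl) = roots-2-X² U
  one (suc (suc _)) (s≤s ()) _

roots-X²-below-valuation : ∀ {p} → Prime p → ∀ {k l} D → k ≤ l →
                           roots (p ^ k) (X²- (+ (p ^ l) * D)) ≡ p ^ (k / 2)
roots-X²-below-valuation {p} pr {k} {l} D k≤l with halve k | ℕP.m≤n⇒∃[o]m+o≡n k≤l
... | h , e , e≤1 , refl , k/2≡h | l′ , refl = begin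
  roots (p ^ (h +ℕ h +ℕ e)) (X²- (+ (p ^ (h +ℕ h +ℕ e +ℕ l′)) * D))
    ≡⟨ cong (λ E → roots (p ^ (h +ℕ h +ℕ e)) (X²- E)) regroup ⟩
  roots (p ^ (h +ℕ h +ℕ e)) (X²- (+ (p ^ (h +ℕ h)) * U))
    ≡⟨ roots-X²-p^[2h+e] pr h e U e≤1 (inj₁ p^e∣U) ⟩
  p ^ h
    ≡⟨ cong (p ^_) k/2≡h ⟨
  p ^ ((h +ℕ h +ℕ e) / 2) ∎
  where
  open ≡-Reasoning
  U = + (p ^ (e +ℕ l′)) * D
  regroup : + (p ^ (h +ℕ h +ℕ e +ℕ l′)) * D ≡ + (p ^ (h +ℕ h)) * U
  regroup = trans (cong (λ n → + (p ^ n) * D) (ℕP.+-assoc (h +ℕ h) e l′)) (+p^[m+n]* p (h +ℕ h) (e +ℕ l′) D)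
  p^e∣U : (p ^ e) ∣ᶻ U
  p^e∣U = ∣m⇒∣m*n D (∣ᶻ-weaken (subst ((p ^ e) ∣ℕ_) (sym (ℕP.^-distribˡ-+-* p e l′)) (ℕD.m∣m*n (p ^ l′)))
                                (∣ᶻ-refl _))

even⇒double : ∀ {l} → 2 ∣ℕ l → Σ ℕ λ q → l ≡ q +ℕ q × l / 2 ≡ q
even⇒double (ℕD.divides q refl) = q , twice q , ℕDM.m*n/n≡m q 2
  where
  twice : ∀ q → q *ℕ 2 ≡ q +ℕ q
  twice = ℕRing.solve-∀

roots-X²-above-even-valuation : ∀ {p} → Prime p → ∀ {k l} q D → l ≡ q +ℕ q → l < k →
  Σ ℕ λ j → roots (p ^ k) (X²- (+ (p ^ l) * D)) ≡ p ^ q *ℕ roots (p ^ suc j) (X²- D)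
roots-X²-above-even-valuation pr {k} q D refl l<k with ℕP.m≤n⇒∃[o]m+o≡n l<k
... | j , refl = j , roots-X²-scaled pr q (suc j) D (sym (ℕP.+-suc (q +ℕ q) j)) refl

roots-X²-nonresidue : ∀ {p} → Prime p → ∀ {k l} D → (∀ z → ¬ p ∣ᶻ z * z - D) → l < k → 2 ∣ℕ l →
                      roots (p ^ k) (X²- (+ (p ^ l) * D)) ≡ 0
roots-X²-nonresidue {p} pr D nonsquare l<k 2∣l with even⇒double 2∣l
... | q , l≡q+q , _ with roots-X²-above-even-valuation pr q D l≡q+q l<k
...   | j , shift = trans shift (trans (cong (p ^ q *ℕ_) none) (ℕP.*-zeroʳ (p ^ q)))
  where
  instance
    _ : NonZero (p ^ suc j)
    _ = ℕP.m^n≢0 p (suc j) {{prime⇒nonZero pr}}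
  none : roots (p ^ suc j) (X²- D) ≡ 0
  none = roots≡0 (p ^ suc j) (X²- D) (λ t d → nonsquare (+ t) (∣ᶻ-weaken (p∣p^[1+k] p j) d))

roots-X²-residue : ∀ {p} → Prime p → ¬ p ∣ᶻ + 2 → ∀ {k l} D → ¬ p ∣ᶻ D → ∀ r → p ∣ᶻ r * r - D →
                   l < k → 2 ∣ℕ l → roots (p ^ k) (X²- (+ (p ^ l) * D)) ≡ 2 *ℕ p ^ (l / 2)
roots-X²-residue {p} pr p∤2 D p∤D r r²≡D l<k 2∣l with even⇒double 2∣l
... | q , l≡q+q , l/2≡q with roots-X²-above-even-valuation pr q D l≡q+q l<k
...   | j , shift = trans shift (trans (cong (p ^ q *ℕ_) (roots-p^-X²-square pr p∤2 D p∤D r r²≡D j))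
                                       (trans (ℕP.*-comm (p ^ q) 2) (cong (λ n → 2 *ℕ p ^ n) (sym l/2≡q))))

p∤D⇒X²-pD-no-root : ∀ {p} → Prime p → ∀ D → ¬ p ∣ᶻ D → ∀ y → ¬ (p *ℕ p) ∣ᶻ (X²- (+ (p ^ 1) * D)) y
p∤D⇒X²-pD-no-root {p} pr D p∤D y d
  with prime∣²⇒∣ pr y (∣ᶻ-respʳ (e₁ (y * y) pD) (∣m∣n⇒∣m+n (∣ᶻ-weaken (ℕD.m∣m*n p) d) p∣pD))
  where
  pD = + (p ^ 1) * D
  e₁ : ∀ a b → a - b + b ≡ a
  e₁ = solve-∀
  p∣pD : p ∣ᶻ pD
  p∣pD = ∣m⇒∣m*n D (∣ᶻ-weaken (ℕD.divides 1 (ℕP.*-comm p 1)) (∣ᶻ-refl (p ^ 1)))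
... | divides z refl =
  p∤D (∣ᶻ-*-cancelʳ p p {{prime⇒nonZero pr}} D (∣ᶻ-respʳ e₂ (∣m∣n⇒∣m-n (∣ᶻ-multiple (p *ℕ p) (z * z)) d)))
  where
  e₂ : z * z * + (p *ℕ p) - (X²- (+ (p ^ 1) * D)) (z * + p) ≡ D * + p
  e₂ = begin
    z * z * + (p *ℕ p) - (X²- (+ (p ^ 1) * D)) (z * + p)
      ≡⟨ cong₂ (λ P P′ → z * z * P - ((z * + p) * (z * + p) - P′ * D)) (ℤP.pos-* p p) (cong +_ (ℕP.*-identityʳ p)) ⟩
    z * z * (+ p * + p) - ((z * + p) * (z * + p) - + p * D)
      ≡⟨ rearrange z (+ p) D ⟩
    D * + p ∎
    where
    open ≡-Reasoning
    rearrange : ∀ z p D → z * z * (p * p) - ((z * p) * (z * p) - p * D) ≡ D * p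
    rearrange = solve-∀

roots-X²-odd-valuation : ∀ {p} → Prime p → ∀ {k l} D → ¬ p ∣ᶻ D → l < k → ¬ 2 ∣ℕ l →
                         roots (p ^ k) (X²- (+ (p ^ l) * D)) ≡ 0
roots-X²-odd-valuation {p} pr {k} {l} D p∤D l<k 2∤l with halve l | ℕP.m≤n⇒∃[o]m+o≡n l<k
... | h , zero , _ , l≡h+h , _ | _ = ⊥-elim (2∤l (ℕD.divides h (trans l≡h+h (twice h))))
  where
  twice : ∀ h → h +ℕ h +ℕ 0 ≡ h *ℕ 2
  twice = ℕRing.solve-∀
... | h , suc zero , _ , refl , _ | j , refl = begin
  roots (p ^ (suc (h +ℕ h +ℕ 1) +ℕ j)) (X²- (+ (p ^ (h +ℕ h +ℕ 1)) * D))
    ≡⟨ roots-X²-scaled pr h (suc (suc j)) (+ (p ^ 1) * D) (reorder h j) (+p^[m+n]* p (h +ℕ h) 1 D) ⟩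
  p ^ h *ℕ roots (p ^ suc (suc j)) (X²- (+ (p ^ 1) * D))
    ≡⟨ cong (p ^ h *ℕ_) (roots≡0 (p ^ suc (suc j)) (X²- (+ (p ^ 1) * D))
         (λ y d → p∤D⇒X²-pD-no-root pr D p∤D (+ y) (∣ᶻ-weaken p*p∣p^[2+j] d))) ⟩
  p ^ h *ℕ 0
    ≡⟨ ℕP.*-zeroʳ (p ^ h) ⟩
  0 ∎
  where
  open ≡-Reasoning
  reorder : ∀ h j → suc (h +ℕ h +ℕ 1) +ℕ j ≡ h +ℕ h +ℕ suc (suc j)
  reorder = ℕRing.solve-∀
  p*p∣p^[2+j] : (p *ℕ p) ∣ℕ p ^ suc (suc j)
  p*p∣p^[2+j] = ℕD.divides (p ^ j) (rearrange p (p ^ j))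
    where
    rearrange : ∀ p q → p *ℕ (p *ℕ q) ≡ q *ℕ (p *ℕ p)
    rearrange = ℕRing.solve-∀
... | h , suc (suc _) , s≤s () , _ | _

roots-X²-2^[m+m]-below : ∀ m {k} D → k ≤ suc (m +ℕ m) → roots (2 ^ k) (X²- (+ (2 ^ (m +ℕ m)) * D)) ≡ 2 ^ (k / 2)
roots-X²-2^[m+m]-below m {k} D k≤ with halve k
... | h , e , e≤1 , refl , k/2≡h with ℕP.m≤n⇒∃[o]m+o≡n h≤m
  where
  h≤m : h ≤ m
  h≤m with h ℕ.≤? m
  ... | yes h≤m = h≤m
  ... | no h≰m = ⊥-elim (ℕP.<-irrefl refl (ℕP.≤-<-trans (ℕP.≤-trans (ℕP.+-mono-≤ m<h m<h) h+h≤k) k<))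
    where
    m<h : suc m ≤ h
    m<h = ℕP.≰⇒> h≰m
    h+h≤k : h +ℕ h ≤ h +ℕ h +ℕ e
    h+h≤k = ℕP.m≤m+n (h +ℕ h) e
    k< : h +ℕ h +ℕ e < suc m +ℕ suc m
    k< = ℕP.≤-trans (s≤s k≤) (s≤s (ℕP.≤-reflexive (sym (ℕP.+-suc m m))))
... | d , refl = begin
  roots (2 ^ (h +ℕ h +ℕ e)) (X²- (+ (2 ^ ((h +ℕ d) +ℕ (h +ℕ d))) * D))
    ≡⟨ cong (λ E → roots (2 ^ (h +ℕ h +ℕ e)) (X²- E)) regroup ⟩
  roots (2 ^ (h +ℕ h +ℕ e)) (X²- (+ (2 ^ (h +ℕ h)) * (+ (2 ^ (d +ℕ d)) * D)))
    ≡⟨ roots-X²-p^[2h+e] prime[2] h e _ e≤1 (inj₂ refl) ⟩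
  2 ^ h
    ≡⟨ cong (2 ^_) k/2≡h ⟨
  2 ^ ((h +ℕ h +ℕ e) / 2) ∎
  where
  open ≡-Reasoning
  reorder : ∀ h d → (h +ℕ d) +ℕ (h +ℕ d) ≡ (h +ℕ h) +ℕ (d +ℕ d)
  reorder = ℕRing.solve-∀
  regroup : + (2 ^ ((h +ℕ d) +ℕ (h +ℕ d))) * D ≡ + (2 ^ (h +ℕ h)) * (+ (2 ^ (d +ℕ d)) * D)
  regroup = trans (cong (λ n → + (2 ^ n) * D) (reorder h d)) (+p^[m+n]* 2 (h +ℕ h) (d +ℕ d) D)

Primitive : ℤ → ℤ → ℤ → Set
Primitive a b c = ∀ {p} → Prime p → p ∣ᶻ a → p ∣ᶻ b → ¬ p ∣ᶻ c

irreducible⇒primitive : ∀ {a b c} → IrreducibleQuadratic a b c → Primitive a b c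
irreducible⇒primitive (_ , content , _) {p} pr (divides qa refl) (divides qb refl) (divides qc refl)
  with content (+ p) qa qb qc (ℤP.*-comm qa (+ p)) (ℤP.*-comm qb (+ p)) (ℤP.*-comm qc (+ p))
... | inj₁ p≡1 = ¬prime[1] (subst Prime (ℤP.+-injective p≡1) pr)
... | inj₂ ()

completing-square : ∀ a b c x → ((+ 4) * a) * quad a b c x ≡ (X²- (disc a b c)) ((+ 2) * a * x + b)
completing-square a b c x = expand a b c x
  where
  expand : ∀ a b c x → ((+ 4) * a) * (a * x * x + b * x + c) ≡
                       ((+ 2) * a * x + b) * ((+ 2) * a * x + b) - (b * b - (+ 4) * a * c)
  expand = solve-∀

numRoots≡roots-X²-disc : ∀ a b c {p} → Prime p → ¬ p ∣ᶻ (+ 2) * a → ∀ k →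
                         numRoots a b c (p ^ k) ≡ roots (p ^ k) (X²- (disc a b c))
numRoots≡roots-X²-disc a b c {p} pr p∤2a k =
  trans (numRoots≡roots a b c (p ^ k))
        (roots-complete-square pr (quad a b c) ((+ 4) * a) ((+ 2) * a) b (disc a b c) p∤4a p∤2a (completing-square a b c) k)
  where
  twice : ∀ a → (+ 4) * a ≡ (+ 2) * ((+ 2) * a)
  twice = solve-∀
  p∤4a : ¬ p ∣ᶻ (+ 4) * a
  p∤4a d with prime∣*⇒∣⊎∣ pr (+ 2) ((+ 2) * a) (∣ᶻ-respʳ (twice a) d)
  ... | inj₁ p∣2  = p∤2a (∣m⇒∣m*n a p∣2)
  ... | inj₂ p∣2a = p∤2a p∣2a

roots-p∤2a : ∀ a b c {p k l} Dp → Prime p → ¬ (+ p) ∣ (+ 2) * a →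
  disc a b c ≡ + (p ^ l) * Dp → ¬ (+ p) ∣ Dp →
  (k ≤ l → numRoots a b c (p ^ k) ≡ p ^ (k / 2)) ×
  (l < k → (¬ (2 ∣ℕ l)) ⊎ legendre Dp p ≡ -1ℤ → numRoots a b c (p ^ k) ≡ 0) ×
  (l < k → 2 ∣ℕ l → legendre Dp p ≡ 1ℤ → numRoots a b c (p ^ k) ≡ 2 *ℕ p ^ (l / 2))
roots-p∤2a a b c {p} {k} {l} Dp pr p∤2a disc≡ p∤Dp =
    (λ k≤l → trans to-X² (roots-X²-below-valuation pr Dp k≤l))
  , no-roots
  , λ l<k 2∣l leg → let (r , r²≡Dp) = legendre≡1⇒square Dp p leg in
      trans to-X² (roots-X²-residue pr p∤2 Dp (∤⇒∤ᶻ p∤Dp) r r²≡Dp l<k 2∣l)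
  where
  instance
    _ : NonZero p
    _ = prime⇒nonZero pr
  p∤2 : ¬ p ∣ᶻ + 2
  p∤2 p∣2 = p∤2a (∣⇒∣ᵤ (∣m⇒∣m*n a p∣2))
  to-X² : numRoots a b c (p ^ k) ≡ roots (p ^ k) (X²- (+ (p ^ l) * Dp))
  to-X² = trans (numRoots≡roots-X²-disc a b c pr (∤⇒∤ᶻ p∤2a) k) (cong (λ E → roots (p ^ k) (X²- E)) disc≡)
  no-roots : l < k → (¬ (2 ∣ℕ l)) ⊎ legendre Dp p ≡ -1ℤ → numRoots a b c (p ^ k) ≡ 0
  no-roots l<k hyp with 2 ℕD.∣? l | hyp
  ... | no 2∤l  | _        = trans to-X² (roots-X²-odd-valuation pr Dp (∤⇒∤ᶻ p∤Dp) l<k 2∤l)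
  ... | yes 2∣l | inj₁ 2∤l = ⊥-elim (2∤l 2∣l)
  ... | yes 2∣l | inj₂ leg = trans to-X² (roots-X²-nonresidue pr Dp (legendre≡-1⇒nonsquare Dp p leg) l<k 2∣l)

roots-p∣a-p∣b : ∀ {a b c} → Primitive a b c → ∀ {p} → Prime p → p ∣ᶻ a → p ∣ᶻ b →
                ∀ k → 1 ≤ k → numRoots a b c (p ^ k) ≡ 0
roots-p∣a-p∣b {a} {b} {c} abc-primitive {p} pr p∣a p∣b (suc j) _ =
  trans (numRoots≡roots a b c (p ^ suc j))
        (roots≡0 (p ^ suc j) (quad a b c) (λ x d → abc-primitive pr p∣a p∣b (p∣c (+ x) (∣ᶻ-weaken (p∣p^[1+k] p j) d))))
  where
  cancel : ∀ a b c x → a * x * x + b * x + c - a * x * x - b * x ≡ c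
  cancel = solve-∀
  p∣c : ∀ x → p ∣ᶻ quad a b c x → p ∣ᶻ c
  p∣c x d = ∣ᶻ-respʳ (cancel a b c x)
    (∣m∣n⇒∣m-n (∣m∣n⇒∣m-n d (∣m⇒∣m*n x (∣m⇒∣m*n x p∣a))) (∣m⇒∣m*n x p∣b))

roots-p∣2a-p∤b : ∀ {p} → Prime p → ∀ {a b} c → p ∣ᶻ (+ 2) * a → ¬ p ∣ᶻ b →
                 ∀ j → roots (p ^ suc j) (quad a b c) ≡ roots (p ^ 1) (quad a b c)
roots-p∣2a-p∤b pr c p∣2a p∤b zero = refl
roots-p∣2a-p∤b {p} pr {a} {b} c p∣2a p∤b (suc j) =
  trans (roots-hensel pr a b c j simple) (roots-p∣2a-p∤b pr c p∣2a p∤b j)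
  where
  cancel : ∀ a b x → (+ 2) * a * x + b - (+ 2) * a * x ≡ b
  cancel = solve-∀
  simple : ∀ x → (p ^ suc j) ∣ᶻ quad a b c x → ¬ p ∣ᶻ (+ 2) * a * x + b
  simple x _ d = p∤b (∣ᶻ-respʳ (cancel a b x) (∣m∣n⇒∣m-n d (∣m⇒∣m*n x p∣2a)))

roots-p∣a : ∀ a b c → Primitive a b c → ∀ p k → Prime p → 1 ≤ k → (+ p) ∣ a →
  ((+ p) ∣ b → numRoots a b c (p ^ k) ≡ 0) × (¬ (+ p) ∣ b → numRoots a b c (p ^ k) ≡ 1)
roots-p∣a a b c abc-primitive p (suc j) pr _ p∣a =
    (λ p∣b → roots-p∣a-p∣b abc-primitive pr p∣ᶻa (∣ᵤ⇒∣ p∣b) (suc j) (s≤s z≤n))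
  , λ p∤b → trans (numRoots≡roots a b c (p ^ suc j))
              (trans (roots-p∣2a-p∤b pr c (∣n⇒∣m*n (+ 2) p∣ᶻa) (∤⇒∤ᶻ {p} {b} p∤b) j) (linear (∤⇒∤ᶻ p∤b)))
  where
  p∣ᶻa : p ∣ᶻ a
  p∣ᶻa = ∣ᵤ⇒∣ p∣a
  instance
    _ : NonZero p
    _ = prime⇒nonZero pr
  drop-ax² : ∀ x → [ p ∣ quad a b c (+ x) ] ≡ [ p ∣ c + b * + x ]
  drop-ax² x = [∣]-cong {p} {quad a b c (+ x)} {p} {c + b * + x}
    (λ d → ∣ᶻ-respʳ (e₁ a b c (+ x)) (∣m∣n⇒∣m-n d p∣ax²))
    (λ d → ∣ᶻ-respʳ (e₂ a b c (+ x)) (∣m∣n⇒∣m+n d p∣ax²))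
    where
    p∣ax² : p ∣ᶻ a * + x * + x
    p∣ax² = ∣m⇒∣m*n (+ x) (∣m⇒∣m*n (+ x) p∣ᶻa)
    e₁ : ∀ a b c x → a * x * x + b * x + c - a * x * x ≡ c + b * x
    e₁ = solve-∀
    e₂ : ∀ a b c x → c + b * x + a * x * x ≡ a * x * x + b * x + c
    e₂ = solve-∀
  linear : ¬ p ∣ᶻ b → roots (p ^ 1) (quad a b c) ≡ 1
  linear p∤b rewrite ℕP.*-identityʳ p = let (u , inv) = inverse-mod-^ pr p∤b 1 in
    trans (∑<-cong p (λ x _ → drop-ax² x)) (roots-linear p c b u (∣ᶻ-weaken (p∣p^[1+k] p 0) inv))

roots-2∤b : ∀ a b c → ¬ (+ 2) ∣ b →
  ((k : ℕ) → 2 ≤ k → numRoots a b c (2 ^ k) ≡ numRoots a b c 2) ×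
  ((+ 2) ∣ a → numRoots a b c 2 ≡ 1) ×
  (¬ (+ 2) ∣ a → ¬ (+ 2) ∣ c → numRoots a b c 2 ≡ 0) ×
  (¬ (+ 2) ∣ a → (+ 2) ∣ c → numRoots a b c 2 ≡ 2)
roots-2∤b a b c 2∤b′ = stable , even-a , odd-a-odd-c , odd-a-even-c
  where
  2∤b : ¬ 2 ∣ᶻ b
  2∤b = ∤⇒∤ᶻ 2∤b′
  2∣b+1 : 2 ∣ᶻ b + 1ℤ
  2∣b+1 = odd⇒2∣+1 b 2∤b
  stable : (k : ℕ) → 2 ≤ k → numRoots a b c (2 ^ k) ≡ numRoots a b c 2
  stable (suc j) _ = trans (numRoots≡roots a b c (2 ^ suc j))
    (trans (roots-p∣2a-p∤b prime[2] c (∣m⇒∣m*n a (∣ᶻ-refl 2)) 2∤b j) (sym (numRoots≡roots a b c 2)))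
  mod-2 : numRoots a b c 2 ≡ [ 2 ∣ c ] +ℕ [ 2 ∣ c + (a + b) ]
  mod-2 = trans (numRoots≡roots a b c 2)
    (trans (cong₂ (λ x y → [ 2 ∣ x ] +ℕ ([ 2 ∣ y ] +ℕ 0)) (at-0 a b c) (at-1 a b c))
           (cong ([ 2 ∣ c ] +ℕ_) (ℕP.+-identityʳ _)))
    where
    at-0 : ∀ a b c → a * + 0 * + 0 + b * + 0 + c ≡ c
    at-0 = solve-∀
    at-1 : ∀ a b c → a * + 1 * + 1 + b * + 1 + c ≡ c + (a + b)
    at-1 = solve-∀
  even-a : (+ 2) ∣ a → numRoots a b c 2 ≡ 1
  even-a 2∣a = trans mod-2
    ([2∣]+[2∣+odd]≡1 c (a + b) (λ 2∣a+b → 2∤b (∣m+n∣m⇒∣n 2∣a+b (∣ᵤ⇒∣ {+ 2} {a} 2∣a))))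
  odd-a : ¬ (+ 2) ∣ a → numRoots a b c 2 ≡ [ 2 ∣ c ] +ℕ [ 2 ∣ c ]
  odd-a 2∤a = trans mod-2 (cong ([ 2 ∣ c ] +ℕ_) ([∣]-cong {2} {c + (a + b)} {2} {c}
    (λ d → ∣m+n∣n⇒∣m d 2∣a+b) (λ d → ∣m∣n⇒∣m+n d 2∣a+b)))
    where
    e : ∀ a b → a + 1ℤ + (b + 1ℤ) - + 2 ≡ a + b
    e = solve-∀
    2∣a+b : 2 ∣ᶻ a + b
    2∣a+b = ∣ᶻ-respʳ (e a b) (∣m∣n⇒∣m-n (∣m∣n⇒∣m+n (odd⇒2∣+1 a (∤⇒∤ᶻ {2} {a} 2∤a)) 2∣b+1) (∣ᶻ-refl 2))
  odd-a-odd-c : ¬ (+ 2) ∣ a → ¬ (+ 2) ∣ c → numRoots a b c 2 ≡ 0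
  odd-a-odd-c 2∤a 2∤c = trans (odd-a 2∤a) (cong (λ n → n +ℕ n) ([∣]-no (∤⇒∤ᶻ {2} {c} 2∤c)))
  odd-a-even-c : ¬ (+ 2) ∣ a → (+ 2) ∣ c → numRoots a b c 2 ≡ 2
  odd-a-even-c 2∤a 2∣c = trans (odd-a 2∤a) (cong (λ n → n +ℕ n) ([∣]-yes (∣ᵤ⇒∣ {+ 2} {c} 2∣c)))

4^m≡2^[m+m] : ∀ m → 4 ^ m ≡ 2 ^ (m +ℕ m)
4^m≡2^[m+m] zero    = refl
4^m≡2^[m+m] (suc m) = trans (cong (4 *ℕ_) (4^m≡2^[m+m] m))
  (trans (double (2 ^ (m +ℕ m))) (cong (λ n → 2 *ℕ 2 ^ n) (sym (ℕP.+-suc m m))))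
  where
  double : ∀ x → 4 *ℕ x ≡ 2 *ℕ (2 *ℕ x)
  double = ℕRing.solve-∀

numRoots≡roots-X²-half-disc : ∀ a b′ c → ¬ 2 ∣ᶻ a → ∀ k →
  numRoots a (b′ * + 2) c (2 ^ k) ≡ roots (2 ^ k) (X²- (b′ * b′ - a * c))
numRoots≡roots-X²-half-disc a b′ c 2∤a k = trans (numRoots≡roots a (b′ * + 2) c (2 ^ k))
  (roots-complete-square prime[2] (quad a (b′ * + 2) c) a a b′ (b′ * b′ - a * c) 2∤a 2∤a (expand a b′ c) k)
  where
  expand : ∀ a b c x → a * (a * x * x + (b * + 2) * x + c) ≡ (a * x + b) * (a * x + b) - (b * b - a * c)
  expand = solve-∀

disc≡4*half-disc : ∀ a b′ c → disc a (b′ * + 2) c ≡ + 4 * (b′ * b′ - a * c)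
disc≡4*half-disc a b′ c = expand b′ a c
  where
  expand : ∀ b a c → (b * + 2) * (b * + 2) - (+ 4) * a * c ≡ (+ 4) * (b * b - a * c)
  expand = solve-∀

roots-2∣b-2∤a : ∀ a b c → (+ 2) ∣ b → ¬ (+ 2) ∣ a → (l k : ℕ) (D′ : ℤ) →
  disc a b c ≡ + (4 ^ l) * D′ → ¬ (+ 4) ∣ D′ →
  (k ≤ 2 *ℕ l ∸ 1 → numRoots a b c (2 ^ k) ≡ 2 ^ (k / 2)) ×
  (k ≡ 2 *ℕ l →
    ((+ 4) ∣ (D′ - 1ℤ) → numRoots a b c (2 ^ k) ≡ 2 ^ l) ×
    (¬ (+ 4) ∣ (D′ - 1ℤ) → numRoots a b c (2 ^ k) ≡ 0)) ×
  (suc (2 *ℕ l) ≤ k →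
    ((+ 8) ∣ (D′ - 1ℤ) → numRoots a b c (2 ^ k) ≡ 2 ^ suc l) ×
    (¬ (+ 8) ∣ (D′ - 1ℤ) → numRoots a b c (2 ^ k) ≡ 0))
roots-2∣b-2∤a a b c 2∣b 2∤a zero k D′ disc≡ 4∤D′ with ∣ᵤ⇒∣ {+ 2} {b} 2∣b
... | divides b′ refl = ⊥-elim (4∤D′ (∣⇒∣ᵤ (divides (b′ * b′ - a * c) (begin
  D′                          ≡⟨ ℤP.*-identityˡ D′ ⟨
  + 1 * D′                    ≡⟨ disc≡ ⟨
  disc a (b′ * + 2) c         ≡⟨ disc≡4*half-disc a b′ c ⟩
  + 4 * (b′ * b′ - a * c)     ≡⟨ ℤP.*-comm (+ 4) _ ⟩
  (b′ * b′ - a * c) * + 4     ∎))))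
  where open ≡-Reasoning
roots-2∣b-2∤a a b c 2∣b 2∤a (suc m) k D′ disc≡ 4∤D′ with ∣ᵤ⇒∣ {+ 2} {b} 2∣b
... | divides b′ refl = below , at , above
  where
  E = b′ * b′ - a * c
  E≡ : E ≡ + (2 ^ (m +ℕ m)) * D′
  E≡ = ℤP.*-cancelˡ-≡ (+ 4) E _ (begin
    + 4 * E                          ≡⟨ disc≡4*half-disc a b′ c ⟨
    disc a (b′ * + 2) c              ≡⟨ disc≡ ⟩
    + (4 *ℕ 4 ^ m) * D′              ≡⟨ cong (_* D′) (ℤP.pos-* 4 (4 ^ m)) ⟩
    + 4 * + (4 ^ m) * D′             ≡⟨ ℤP.*-assoc (+ 4) (+ (4 ^ m)) D′ ⟩
    + 4 * (+ (4 ^ m) * D′)           ≡⟨ cong (λ n → + 4 * (+ n * D′)) (4^m≡2^[m+m] m) ⟩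
    + 4 * (+ (2 ^ (m +ℕ m)) * D′)    ∎)
    where open ≡-Reasoning
  scaled : ∀ {k} e → k ≡ m +ℕ m +ℕ e → numRoots a (b′ * + 2) c (2 ^ k) ≡ 2 ^ m *ℕ roots (2 ^ e) (X²- D′)
  scaled {k} e k≡ = trans (numRoots≡roots-X²-half-disc a b′ c (∤⇒∤ᶻ 2∤a) k) (roots-X²-scaled prime[2] m e D′ k≡ E≡)
  below : k ≤ 2 *ℕ suc m ∸ 1 → numRoots a (b′ * + 2) c (2 ^ k) ≡ 2 ^ (k / 2)
  below k≤ = trans (numRoots≡roots-X²-half-disc a b′ c (∤⇒∤ᶻ 2∤a) k)
    (trans (cong (λ E → roots (2 ^ k) (X²- E)) E≡) (roots-X²-2^[m+m]-below m D′ (subst (k ≤_) 2[1+m]∸1 k≤)))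
    where
    2[1+m]∸1 : 2 *ℕ suc m ∸ 1 ≡ suc (m +ℕ m)
    2[1+m]∸1 = trans (ℕP.+-suc m (m +ℕ 0)) (cong (λ n → suc (m +ℕ n)) (ℕP.+-identityʳ m))
  at : k ≡ 2 *ℕ suc m →
    ((+ 4) ∣ (D′ - 1ℤ) → numRoots a (b′ * + 2) c (2 ^ k) ≡ 2 ^ suc m) ×
    (¬ (+ 4) ∣ (D′ - 1ℤ) → numRoots a (b′ * + 2) c (2 ^ k) ≡ 0)
  at k≡ = (λ 4∣D′-1 → trans (scaled 2 k≡′)
              (trans (cong (2 ^ m *ℕ_) (roots-4-X²-1 D′ (∣ᵤ⇒∣ 4∣D′-1))) (ℕP.*-comm (2 ^ m) 2)))
        , (λ 4∤D′-1 → trans (scaled 2 k≡′)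
              (trans (cong (2 ^ m *ℕ_) (roots-4-X²-0 D′ (∤⇒∤ᶻ 4∤D′) (∤⇒∤ᶻ 4∤D′-1))) (ℕP.*-zeroʳ (2 ^ m))))
    where
    reorder : ∀ m → 2 *ℕ suc m ≡ m +ℕ m +ℕ 2
    reorder = ℕRing.solve-∀
    k≡′ : k ≡ m +ℕ m +ℕ 2
    k≡′ = trans k≡ (reorder m)
  above : suc (2 *ℕ suc m) ≤ k →
    ((+ 8) ∣ (D′ - 1ℤ) → numRoots a (b′ * + 2) c (2 ^ k) ≡ 2 ^ suc (suc m)) ×
    (¬ (+ 8) ∣ (D′ - 1ℤ) → numRoots a (b′ * + 2) c (2 ^ k) ≡ 0)
  above k> with ℕP.m≤n⇒∃[o]m+o≡n k>
  ... | i , refl = (λ 8∣D′-1 → trans (scaled (3 +ℕ i) (reorder m i))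
                     (trans (cong (2 ^ m *ℕ_) (roots-2^-X²-1mod8 D′ (∣ᵤ⇒∣ 8∣D′-1) i)) (quadruple (2 ^ m))))
                 , (λ 8∤D′-1 → trans (scaled (3 +ℕ i) (reorder m i))
                     (trans (cong (2 ^ m *ℕ_) (none 8∤D′-1)) (ℕP.*-zeroʳ (2 ^ m))))
    where
    reorder : ∀ m i → suc (2 *ℕ suc m) +ℕ i ≡ m +ℕ m +ℕ (3 +ℕ i)
    reorder = ℕRing.solve-∀
    quadruple : ∀ x → x *ℕ 4 ≡ 2 *ℕ (2 *ℕ x)
    quadruple = ℕRing.solve-∀
    octuple : ∀ x → 2 *ℕ (2 *ℕ (2 *ℕ x)) ≡ x *ℕ 8
    octuple = ℕRing.solve-∀
    none : ¬ (+ 8) ∣ (D′ - 1ℤ) → roots (2 ^ (3 +ℕ i)) (X²- D′) ≡ 0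
    none 8∤D′-1 = roots≡0 (2 ^ (3 +ℕ i)) (X²- D′) (λ y d →
      roots-X²≡0⇒no-root 8 D′ (roots-8-X²-0 D′ (∤⇒∤ᶻ 4∤D′) (∤⇒∤ᶻ 8∤D′-1)) (+ y)
        (∣ᶻ-weaken (ℕD.divides (2 ^ i) (octuple (2 ^ i))) d))

mainTheorem3 : (a b c : ℤ) → IrreducibleQuadratic a b c →
    -- (1)
    ((p k l : ℕ) (Dp : ℤ) → Prime p → 1 ≤ k → ¬ ((+ p) ∣ ((+ 2) * a)) →
      disc a b c ≡ (+ (p ^ l)) * Dp → ¬ ((+ p) ∣ Dp) →
      (k ≤ l → numRoots a b c (p ^ k) ≡ p ^ (k / 2)) ×
      (l < k → ((¬ (2 ∣ℕ l)) ⊎ legendre Dp p ≡ -1ℤ) → numRoots a b c (p ^ k) ≡ 0) ×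
      (l < k → 2 ∣ℕ l → legendre Dp p ≡ 1ℤ → numRoots a b c (p ^ k) ≡ 2 *ℕ p ^ (l / 2)))
  × -- (2)
    ((p k : ℕ) → Prime p → 1 ≤ k → (+ p) ∣ a → ¬ (p ≡ 2) →
      ((+ p) ∣ b → numRoots a b c (p ^ k) ≡ 0) ×
      (¬ ((+ p) ∣ b) → numRoots a b c (p ^ k) ≡ 1))
  × -- (3)
    (¬ ((+ 2) ∣ b) →
      ((k : ℕ) → 2 ≤ k → numRoots a b c (2 ^ k) ≡ numRoots a b c 2) ×
      ((+ 2) ∣ a → numRoots a b c 2 ≡ 1) ×
      (¬ ((+ 2) ∣ a) → ¬ ((+ 2) ∣ c) → numRoots a b c 2 ≡ 0) ×
      (¬ ((+ 2) ∣ a) → (+ 2) ∣ c → numRoots a b c 2 ≡ 2))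
  × -- (4)
    ((+ 2) ∣ b → (+ 2) ∣ a → (k : ℕ) → 1 ≤ k → numRoots a b c (2 ^ k) ≡ 0)
  × -- (5)
    ((+ 2) ∣ b → ¬ ((+ 2) ∣ a) → (l k : ℕ) (D′ : ℤ) → 1 ≤ k →
      disc a b c ≡ (+ (4 ^ l)) * D′ → ¬ ((+ 4) ∣ D′) →
      (k ≤ 2 *ℕ l ∸ 1 → numRoots a b c (2 ^ k) ≡ 2 ^ (k / 2)) ×
      (k ≡ 2 *ℕ l →
        ((+ 4) ∣ (D′ - 1ℤ) → numRoots a b c (2 ^ k) ≡ 2 ^ l) ×
        (¬ ((+ 4) ∣ (D′ - 1ℤ)) → numRoots a b c (2 ^ k) ≡ 0)) ×
      (suc (2 *ℕ l) ≤ k →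
        ((+ 8) ∣ (D′ - 1ℤ) → numRoots a b c (2 ^ k) ≡ 2 ^ suc l) ×
        (¬ ((+ 8) ∣ (D′ - 1ℤ)) → numRoots a b c (2 ^ k) ≡ 0)))
mainTheorem3 a b c irr =
    (λ p k l Dp pr _ → roots-p∤2a a b c Dp pr)
  , (λ p k pr 1≤k p∣a _ → roots-p∣a a b c abc-primitive p k pr 1≤k p∣a)
  , roots-2∤b a b c
  , (λ 2∣b 2∣a → roots-p∣a-p∣b abc-primitive prime[2] (∣ᵤ⇒∣ 2∣a) (∣ᵤ⇒∣ 2∣b))
  , (λ 2∣b 2∤a l k D′ _ → roots-2∣b-2∤a a b c 2∣b 2∤a l k D′)
  where
  abc-primitive : Primitive a b c
  abc-primitive = irreducible⇒primitive irr
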